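{- Let $\Gamma$ be a semicomplete multipartite commutative weakly distance-regular digraph such that $T=\{q\mid(1,q-1)\in\tilde\partial(\Gamma)\}$ has exactly one element. Then $\Gamma$ is isomorphic to one of: (a) an $l$-coclique extension of a semicomplete weakly distance-regular digraph with girth $2$ or $3$, where $l\geq 2$; (b) an $n$-coclique extension of a doubly regular $(k,l)$-team tournament of Type II with parameters $\left(\frac{(k-2)l}{4},\frac{(k-2)l}{4},\frac{l^2(k-1)}{4(l-1)}\right)$, where $k,l\geq2$ and $n\geq1$.
   Context: A digraph $\Gamma$ has a finite vertex set $V\Gamma$ and arcs $A\Gamma$ that are ordered pairs of distinct vertices; $N^+(x)$ denotes the out-neighbours of $x$. $\partial(x,y)$ is the length of a shortest directed path from $x$ to $y$; $\Gamma$ is strongly connected if all are finite; a circuit of length $r$ is a closed directed walk $(w_0,\dots,w_{r-1})$ of distinct-consecutive arcs with $(w_{r-1},w_0)$ an arc, and the girth is the length of a shortest circuit. $\tilde\partial(x,y)=(\partial(x,y),\partial(y,x))$, $\tilde\partial(\Gamma)$ is the set of these pairs, $\Gamma_{\tilde i}=\{(x,y):\tilde\partial(x,y)=\tilde i\}$. A strongly connected $\Gamma$ is weakly distance-regular if $A\Gamma$ is not symmetric and for all $\tilde i,\tilde j,\tilde h\in\tilde\partial(\Gamma)$ the number $|\{z:(x,z)\in\Gamma_{\tilde i},(z,y)\in\Gamma_{\tilde j}\}|$ is the same for all $(x,y)\in\Gamma_{\tilde h}$; commutative if this number is symmetric in $\tilde i,\tilde j$. The underlying graph joins $x,y$ iff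 $(x,y)$ or $(y,x)$ is an arc; $\Gamma$ is semicomplete if it is complete, semicomplete multipartite if it is a complete multipartite graph with at least 2 parts, all of size at least 2. The lexicographic product $\Gamma\circ\Sigma$ has vertex set $V\Gamma\times V\Sigma$ with $((u_1,u_2),(v_1,v_2))$ an arc iff $(u_1,v_1)\in A\Gamma$ or ($u_1=v_1$ and $(u_2,v_2)\in A\Sigma$); an $n$-coclique extension of $\Gamma$ is $\Gamma\circ\overline K_n$, $\overline K_n$ the arcless digraph on $n$ vertices. A $(k,l)$-team tournament is a digraph of girth at least 3 whose underlying graph is the complete multipartite graph with $k$ parts $V_1,\dots,V_k$ each of size $l$. A regular such digraph (all in- and out-degrees equal) with adjacency matrix $A$ is a doubly regular $(k,l)$-team tournament with parameters $(\alpha,\beta,\gamma)$ if $A^2=\alpha A+\beta A^{\top}+\gamma(J-I-A-A^{\top})$; it is of Type II if $\beta=\alpha$, $l$ is even and $|N^+(x)\cap V_i|=l/2$ for all $i$ and all $x\notin V_i$. -}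

module Defs where

open import Data.Nat using (ℕ; zero; suc; _+_; _*_; _∸_; _≤_; _≡ᵇ_)
open import Data.Bool using (Bool; true; false; _∧_; _∨_; if_then_else_)
open import Data.Fin using (Fin; zero; suc; _≟_; remQuot)
open import Data.Product using (Σ; ∃; ∃-syntax; ∃₂; _×_; _,_; proj₁; proj₂)
open import Data.Sum using (_⊎_)
open import Relation.Nullary using (¬_)
open import Relation.Nullary.Decidable using (⌊_⌋; yes; no)
open import Relation.Binary.PropositionalEquality using (_≡_; _≢_; refl)
open import Function.Bundles using (_↔_; Inverse)

record Digraph : Set where
  field
    size     : ℕ
    arc      : Fin size → Fin size → Bool
    loopless : ∀ x → arc x x ≡ false
open Digraph public

V : Digraph → Set
V Γ = Fin (size Γ)

anyFin : ∀ {n} → (Fin n → Bool) → Bool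
anyFin {zero}  f = false
anyFin {suc n} f = f zero ∨ anyFin (λ i → f (suc i))

countFin : ∀ {n} → (Fin n → Bool) → ℕ
countFin {zero}  f = 0
countFin {suc n} f = (if f zero then 1 else 0) + countFin (λ i → f (suc i))

b2n : Bool → ℕ
b2n true  = 1
b2n false = 0

walk : (Γ : Digraph) → ℕ → V Γ → V Γ → Bool
walk Γ zero    x y = ⌊ x ≟ y ⌋
walk Γ (suc k) x y = anyFin (λ z → arc Γ x z ∧ walk Γ k z y)

StronglyConnected : Digraph → Set
StronglyConnected Γ = ∀ x y → ∃[ k ] walk Γ k x y ≡ true

-- least k in [start, start+fuel) with P k, or start+fuel if none
firstFrom : (ℕ → Bool) → ℕ → ℕ → ℕ
firstFrom P k zero     = k
firstFrom P k (suc f)  = if P k then k else firstFrom P (suc k) f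

-- ∂(x,y): length of a shortest directed path from x to y
-- (a shortest path has length < size; value `size` is returned if y is unreachable,
--  which never happens for strongly connected digraphs)
dist : (Γ : Digraph) → V Γ → V Γ → ℕ
dist Γ x y = firstFrom (λ k → walk Γ k x y) 0 (size Γ)

dist~ : (Γ : Digraph) → V Γ → V Γ → ℕ × ℕ
dist~ Γ x y = (dist Γ x y , dist Γ y x)

eqPair : ℕ × ℕ → ℕ × ℕ → Bool
eqPair (a , b) (c , d) = (a ≡ᵇ c) ∧ (b ≡ᵇ d)

pnum : (Γ : Digraph) → ℕ × ℕ → ℕ × ℕ → V Γ → V Γ → ℕ
pnum Γ i j x y = countFin (λ z → eqPair (dist~ Γ x z) i ∧ eqPair (dist~ Γ z y) j)

NonSymmetric : Digraph → Set
NonSymmetric Γ = ∃₂ λ (x y : V Γ) → (arc Γ x y ≡ true) × (arc Γ y x ≡ false)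

-- weakly distance-regular (the numbers are required to be constant on each Γ_h;
-- for i or j outside ∂̃(Γ) they are 0 anyway)
WeaklyDistanceRegular : Digraph → Set
WeaklyDistanceRegular Γ =
  NonSymmetric Γ × StronglyConnected Γ ×
  (∀ (i j : ℕ × ℕ) (x y x' y' : V Γ) → dist~ Γ x y ≡ dist~ Γ x' y' →
     pnum Γ i j x y ≡ pnum Γ i j x' y')

Commutative : Digraph → Set
Commutative Γ = ∀ (i j : ℕ × ℕ) (x y : V Γ) → pnum Γ i j x y ≡ pnum Γ j i x y

adj : (Γ : Digraph) → V Γ → V Γ → Bool
adj Γ x y = arc Γ x y ∨ arc Γ y x

Semicomplete : Digraph → Set
Semicomplete Γ = ∀ (x y : V Γ) → x ≢ y → adj Γ x y ≡ true

partSize : ∀ {n m} → (Fin n → Fin m) → Fin m → ℕ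
partSize part i = countFin (λ x → ⌊ part x ≟ i ⌋)

CompleteMultipartiteWith : (Γ : Digraph) {m : ℕ} → (V Γ → Fin m) → Set
CompleteMultipartiteWith Γ part =
  ∀ x y → ((adj Γ x y ≡ true → part x ≢ part y) × (part x ≢ part y → adj Γ x y ≡ true))

SemicompleteMultipartite : Digraph → Set
SemicompleteMultipartite Γ =
  ∃[ m ] Σ (V Γ → Fin m) λ part →
    (2 ≤ m) × (∀ i → 2 ≤ partSize part i) × CompleteMultipartiteWith Γ part

HasCircuit : Digraph → ℕ → Set
HasCircuit Γ r = ∃[ x ] walk Γ r x x ≡ true

Girth : Digraph → ℕ → Set
Girth Γ g = HasCircuit Γ g × (∀ r → 1 ≤ r → r Data.Nat.< g → ¬ HasCircuit Γ r)

GirthAtLeast : Digraph → ℕ → Set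
GirthAtLeast Γ g = ∀ r → 1 ≤ r → r Data.Nat.< g → ¬ HasCircuit Γ r

∨-false : ∀ {a b} → a ≡ false → b ≡ false → (a ∨ b) ≡ false
∨-false refl refl = refl

∧-false : ∀ a {b} → b ≡ false → (a ∧ b) ≡ false
∧-false true  refl = refl
∧-false false refl = refl

fstV : (Γ Δ : Digraph) → Fin (size Γ * size Δ) → V Γ
fstV Γ Δ u = proj₁ (remQuot {size Γ} (size Δ) u)

sndV : (Γ Δ : Digraph) → Fin (size Γ * size Δ) → V Δ
sndV Γ Δ u = proj₂ (remQuot {size Γ} (size Δ) u)

lexArc : (Γ Δ : Digraph) → Fin (size Γ * size Δ) → Fin (size Γ * size Δ) → Bool
lexArc Γ Δ u v =
  arc Γ (fstV Γ Δ u) (fstV Γ Δ v) ∨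
  (⌊ fstV Γ Δ u ≟ fstV Γ Δ v ⌋ ∧ arc Δ (sndV Γ Δ u) (sndV Γ Δ v))

lex : Digraph → Digraph → Digraph
lex Γ Δ = record
  { size = size Γ * size Δ
  ; arc = lexArc Γ Δ
  ; loopless = λ u → ∨-false (loopless Γ (fstV Γ Δ u))
                       (∧-false ⌊ fstV Γ Δ u ≟ fstV Γ Δ u ⌋ (loopless Δ (sndV Γ Δ u))) }

coclique : ℕ → Digraph
coclique n = record { size = n ; arc = λ _ _ → false ; loopless = λ _ → refl }

cocliqueExt : Digraph → ℕ → Digraph
cocliqueExt Γ n = lex Γ (coclique n)

Isomorphic : Digraph → Digraph → Set
Isomorphic Γ Δ = Σ (V Γ ↔ V Δ) λ f →
  ∀ x y → arc Γ x y ≡ arc Δ (Inverse.to f x) (Inverse.to f y)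

TeamTournament : (Δ : Digraph) (k l : ℕ) → (V Δ → Fin k) → Set
TeamTournament Δ k l part =
  GirthAtLeast Δ 3 × (∀ i → partSize part i ≡ l) × CompleteMultipartiteWith Δ part

outdeg indeg : (Δ : Digraph) → V Δ → ℕ
outdeg Δ x = countFin (λ z → arc Δ x z)
indeg  Δ x = countFin (λ z → arc Δ z x)

Regular : Digraph → Set
Regular Δ = ∃[ d ] ∀ x → (outdeg Δ x ≡ d) × (indeg Δ x ≡ d)

-- entrywise A² = αA + βAᵀ + γ(J − I − A − Aᵀ)
DoublyRegularEq : (Δ : Digraph) → ℕ → ℕ → ℕ → Set
DoublyRegularEq Δ α β γ = ∀ x y →
  countFin (λ z → arc Δ x z ∧ arc Δ z y) ≡
    α * b2n (arc Δ x y) + β * b2n (arc Δ y x) +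
    γ * (1 ∸ (b2n ⌊ x ≟ y ⌋ + b2n (arc Δ x y) + b2n (arc Δ y x)))

DoublyRegularTeamTournament : (Δ : Digraph) (k l : ℕ) → (V Δ → Fin k) → ℕ → ℕ → ℕ → Set
DoublyRegularTeamTournament Δ k l part α β γ =
  TeamTournament Δ k l part × Regular Δ × DoublyRegularEq Δ α β γ

TypeII : (Δ : Digraph) (k l : ℕ) → (V Δ → Fin k) → ℕ → ℕ → Set
TypeII Δ k l part α β =
  (β ≡ α) × (∃[ h ] l ≡ 2 * h) ×
  (∀ x i → part x ≢ i → 2 * countFin (λ z → arc Δ x z ∧ ⌊ part z ≟ i ⌋) ≡ l)

InT : (Γ : Digraph) → ℕ → Set
InT Γ q = ∃₂ λ (x y : V Γ) → dist~ Γ x y ≡ (1 , q ∸ 1)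

ExactlyOneT : Digraph → Set
ExactlyOneT Γ = ∃[ q ] InT Γ q × (∀ q' → InT Γ q' → q' ≡ q)

CaseA : Digraph → Set
CaseA Γ = ∃[ Σ' ] ∃[ l ] (2 ≤ l) × Semicomplete Σ' × WeaklyDistanceRegular Σ' ×
  (Girth Σ' 2 ⊎ Girth Σ' 3) × Isomorphic Γ (cocliqueExt Σ' l)

CaseB : Digraph → Set
CaseB Γ = ∃[ k ] ∃[ l ] ∃[ n ] ∃[ Δ ] Σ (V Δ → Fin k) λ part → ∃[ α ] ∃[ β ] ∃[ γ ]
  (2 ≤ k) × (2 ≤ l) × (1 ≤ n) ×
  DoublyRegularTeamTournament Δ k l part α β γ × TypeII Δ k l part α β ×
  (4 * α ≡ (k ∸ 2) * l) × (4 * β ≡ (k ∸ 2) * l) × (4 * (l ∸ 1) * γ ≡ l * l * (k ∸ 1)) ×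
  Isomorphic Γ (cocliqueExt Δ n)

{-# OPTIONS --safe #-}
module Submission where

-- Since T = {q}, every arc (x, y) has ∂̃(x, y) = (1, q − 1) with q ≠ 2, so Γ has no digons. Weak
-- distance-regularity and commutativity make Γ regular of some valency d with parts of a common size L, and
-- two vertices of one part have no 2-path between them exactly when they have the same out-neighbours (twins).
-- If every part consists of twins, Γ is the L-coclique extension of the tournament Q on the parts; Q has
-- diameter 2 and girth 3, and it is weakly distance-regular because its intersection numbers are combinations
-- of entries of products of I, A and Aᵀ, each of which appears L-fold in Γ. Otherwise, comparing the
-- out-neighbours that the two ends of an arc have in a fixed part shows that every vertex sends exactly L/2
-- arcs into each other part; the twin classes then have a common size n, and the quotient Δ of Γ by twins is a
-- doubly regular team tournament of Type II whose parameters come from double counting 2-paths.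

open import Defs
import Data.Nat.Properties as ℕ
open import Algebra.Properties.Semiring.Sum ℕ.+-*-semiring
  using (sum; sum-cong-≗; ∑-distrib-+; ∑-comm; *-distribˡ-sum; *-distribʳ-sum)
open import Axiom.UniquenessOfIdentityProofs using (module Decidable⇒UIP)
open import Data.Bool using (Bool; true; false; _∧_; _∨_; not; if_then_else_)
open import Data.Bool.Properties
  using (∧-conicalˡ; ∧-conicalʳ; ∧-zeroʳ; ∧-idem; ∧-comm; ∨-identityʳ) renaming (_≟_ to _≟ᴮ_)
open import Data.Empty using (⊥-elim)
open import Data.Fin using (Fin; _≟_; combine; remQuot) renaming (zero to fzero; suc to fsuc)
open import Data.Fin.Properties using (remQuot-combine; combine-remQuot; any?)
open import Data.Maybe using (Maybe; just; nothing) renaming (map to mapᴹ)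
open import Data.Maybe.Properties using (just-injective)
open import Data.Nat using (ℕ; zero; suc; _+_; _*_; _∸_; _≤_; _<_; z≤n; s≤s; _≡ᵇ_; NonZero; >-nonZero; ≢-nonZero)
open import Data.Nat.Properties
  using (+-comm; +-assoc; +-identityʳ; *-identityʳ; *-zeroʳ; *-comm; +-cancelˡ-≡; +-cancelʳ-≡; *-cancelˡ-≡; *-suc;
         m+n≡0⇒m≡0; m+n≡0⇒n≡0; +-mono-≤; ≤-trans; ≤-refl; ≤-reflexive; <-irrefl; ≤∧≢⇒<; n≤1+n; +-suc)
open import Data.Nat.Tactic.RingSolver using (solve-∀)
open import Data.Product using (∃; ∃-syntax; _×_; _,_; proj₁; proj₂)
open import Data.Sum using (_⊎_; inj₁; inj₂)
open import Function using (_∘_)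
open import Function.Bundles using (mk↔ₛ′)
open import Relation.Binary.PropositionalEquality
  using (_≡_; _≢_; refl; sym; trans; cong; cong₂; subst; module ≡-Reasoning)
open import Relation.Nullary using (¬_; Dec; yes; no; _×-dec_; ¬?)
open import Relation.Nullary.Decidable using (⌊_⌋; decidable-stable)

true≢false : true ≢ false
true≢false ()

bool-ext : ∀ {a b} → (a ≡ true → b ≡ true) → (b ≡ true → a ≡ true) → a ≡ b
bool-ext {true}  {true}  _ _ = refl
bool-ext {false} {false} _ _ = refl
bool-ext {true}  {false} f _ = sym (f refl)
bool-ext {false} {true}  _ g = g refl

∧-exclusive : ∀ {a b} → (a ≡ true → b ≡ false) → (a ∧ b) ≡ false
∧-exclusive {false} _ = refl
∧-exclusive {true}  f = f refl

b2n-∧ : ∀ a b → b2n (a ∧ b) ≡ b2n a * b2n b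
b2n-∧ true  b = sym (+-identityʳ (b2n b))
b2n-∧ false b = refl

⌊≟⌋-refl : ∀ {n} (i : Fin n) → ⌊ i ≟ i ⌋ ≡ true
⌊≟⌋-refl i with i ≟ i
... | yes _  = refl
... | no i≢i = ⊥-elim (i≢i refl)

⌊≟⌋-≢ : ∀ {n} {i j : Fin n} → i ≢ j → ⌊ i ≟ j ⌋ ≡ false
⌊≟⌋-≢ {i = i} {j} i≢j with i ≟ j
... | yes i≡j = ⊥-elim (i≢j i≡j)
... | no _    = refl

⌊≟⌋⇒≡ : ∀ {n} {i j : Fin n} → ⌊ i ≟ j ⌋ ≡ true → i ≡ j
⌊≟⌋⇒≡ {i = i} {j} e with i ≟ j
... | yes i≡j = i≡j

⌊suc≟suc⌋ : ∀ {n} (i j : Fin n) → ⌊ fsuc i ≟ fsuc j ⌋ ≡ ⌊ i ≟ j ⌋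
⌊suc≟suc⌋ i j with i ≟ j
... | yes _ = refl
... | no _  = refl

≡ᵇ-refl : ∀ n → (n ≡ᵇ n) ≡ true
≡ᵇ-refl zero    = refl
≡ᵇ-refl (suc n) = ≡ᵇ-refl n

≡ᵇ-true⇒≡ : ∀ m n → (m ≡ᵇ n) ≡ true → m ≡ n
≡ᵇ-true⇒≡ zero    zero    _ = refl
≡ᵇ-true⇒≡ (suc m) (suc n) e = cong suc (≡ᵇ-true⇒≡ m n e)

-- Finite sums and counting

δ : ∀ {n} → Fin n → Fin n → ℕ
δ i j = b2n ⌊ i ≟ j ⌋

δ-sym : ∀ {n} (i j : Fin n) → δ i j ≡ δ j i
δ-sym i j with i ≟ j | j ≟ i
... | yes _   | yes _   = refl
... | no _    | no _    = refl
... | yes i≡j | no j≢i  = ⊥-elim (j≢i (sym i≡j))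
... | no i≢j  | yes j≡i = ⊥-elim (i≢j (sym j≡i))

countFin≡sum : ∀ {n} (f : Fin n → Bool) → countFin f ≡ sum (λ i → b2n (f i))
countFin≡sum {zero}  f = refl
countFin≡sum {suc n} f with f fzero
... | true  = cong suc (countFin≡sum (λ i → f (fsuc i)))
... | false = countFin≡sum (λ i → f (fsuc i))

sum-const : ∀ {n} (c : ℕ) → sum {n} (λ _ → c) ≡ n * c
sum-const {zero}  c = refl
sum-const {suc n} c = cong (c +_) (sum-const {n} c)

∑-distrib-+₃ : ∀ {n} (f g h : Fin n → ℕ) → sum (λ z → f z + g z + h z) ≡ sum f + sum g + sum h
∑-distrib-+₃ f g h = trans (∑-distrib-+ (λ z → f z + g z) h) (cong (_+ sum h) (∑-distrib-+ f g))

sum-mono : ∀ {n} {f g : Fin n → ℕ} → (∀ i → f i ≤ g i) → sum f ≤ sum g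
sum-mono {zero}  f≤g = z≤n
sum-mono {suc n} f≤g = +-mono-≤ (f≤g fzero) (sum-mono (λ i → f≤g (fsuc i)))

sum≡0⇒≡0 : ∀ {n} (f : Fin n → ℕ) → sum f ≡ 0 → ∀ i → f i ≡ 0
sum≡0⇒≡0 {suc n} f e fzero    = m+n≡0⇒m≡0 (f fzero) e
sum≡0⇒≡0 {suc n} f e (fsuc i) = sum≡0⇒≡0 (λ i → f (fsuc i)) (m+n≡0⇒n≡0 (f fzero) e) i

sum≢0⇒∃≢0 : ∀ {n} (f : Fin n → ℕ) → sum f ≢ 0 → ∃[ i ] f i ≢ 0
sum≢0⇒∃≢0 {zero}  f ne = ⊥-elim (ne refl)
sum≢0⇒∃≢0 {suc n} f ne with f fzero ℕ.≟ 0
... | no f0≢0 = fzero , f0≢0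
... | yes f0≡0 with sum≢0⇒∃≢0 (λ i → f (fsuc i)) (λ e → ne (cong₂ _+_ f0≡0 e))
...   | i , fi≢0 = fsuc i , fi≢0

sum-δ : ∀ {n} (i : Fin n) (f : Fin n → ℕ) → sum (λ j → δ i j * f j) ≡ f i
sum-δ {suc n} fzero    f = trans (cong (f fzero + 0 +_) (trans (sum-const {n} 0) (*-zeroʳ n)))
                                 (trans (+-identityʳ _) (+-identityʳ _))
sum-δ {suc n} (fsuc i) f =
  trans (sum-cong-≗ (λ j → cong (λ b → b2n b * f (fsuc j)) (⌊suc≟suc⌋ i j))) (sum-δ i (λ j → f (fsuc j)))

sum-δʳ : ∀ {n} (i : Fin n) (f : Fin n → ℕ) → sum (λ j → δ j i * f j) ≡ f i
sum-δʳ i f = trans (sum-cong-≗ (λ j → cong (_* f j) (δ-sym j i))) (sum-δ i f)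

sum-δ-1 : ∀ {n} (i : Fin n) → sum (δ i) ≡ 1
sum-δ-1 i = trans (sum-cong-≗ (λ j → sym (*-identityʳ (δ i j)))) (sum-δ i (λ _ → 1))

sum-product-expansion : ∀ {n p r} (c : Fin p → ℕ) (x : Fin p → Fin n → ℕ) (e : Fin r → ℕ) (y : Fin r → Fin n → ℕ) →
  sum (λ k → sum (λ a → c a * x a k) * sum (λ b → e b * y b k)) ≡
  sum (λ a → sum (λ b → c a * e b * sum (λ k → x a k * y b k)))
sum-product-expansion c x e y = begin
  sum (λ k → sum (λ a → c a * x a k) * sum (λ b → e b * y b k))
    ≡⟨ sum-cong-≗ (λ k → *-distribʳ-sum _ (λ a → c a * x a k)) ⟩
  sum (λ k → sum (λ a → c a * x a k * sum (λ b → e b * y b k)))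
    ≡⟨ sum-cong-≗ (λ k → sum-cong-≗ (λ a → *-distribˡ-sum (c a * x a k) (λ b → e b * y b k))) ⟩
  sum (λ k → sum (λ a → sum (λ b → c a * x a k * (e b * y b k))))
    ≡⟨ ∑-comm (λ k a → sum (λ b → c a * x a k * (e b * y b k))) ⟩
  sum (λ a → sum (λ k → sum (λ b → c a * x a k * (e b * y b k))))
    ≡⟨ sum-cong-≗ (λ a → ∑-comm (λ k b → c a * x a k * (e b * y b k))) ⟩
  sum (λ a → sum (λ b → sum (λ k → c a * x a k * (e b * y b k))))
    ≡⟨ sum-cong-≗ (λ a → sum-cong-≗ (λ b → sum-cong-≗ (λ k → regroup (c a) (x a k) (e b) (y b k)))) ⟩
  sum (λ a → sum (λ b → sum (λ k → c a * e b * (x a k * y b k))))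
    ≡⟨ sum-cong-≗ (λ a → sum-cong-≗ (λ b → sym (*-distribˡ-sum (c a * e b) (λ k → x a k * y b k)))) ⟩
  sum (λ a → sum (λ b → c a * e b * sum (λ k → x a k * y b k))) ∎
  where
  open ≡-Reasoning
  regroup : ∀ c x e y → c * x * (e * y) ≡ c * e * (x * y)
  regroup = solve-∀

sum-fibres : ∀ {N c} (g : Fin N → Fin c) (f : Fin N → ℕ) →
  sum f ≡ sum (λ k → sum (λ z → δ (g z) k * f z))
sum-fibres g f = sym (begin
  sum (λ k → sum (λ z → δ (g z) k * f z))  ≡⟨ ∑-comm (λ k z → δ (g z) k * f z) ⟩
  sum (λ z → sum (λ k → δ (g z) k * f z))  ≡⟨ sum-cong-≗ (λ z → sym (*-distribʳ-sum (f z) (δ (g z)))) ⟩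
  sum (λ z → sum (δ (g z)) * f z)          ≡⟨ sum-cong-≗ (λ z → cong (_* f z) (sum-δ-1 (g z))) ⟩
  sum (λ z → 1 * f z)                      ≡⟨ sum-cong-≗ (λ z → ℕ.*-identityˡ (f z)) ⟩
  sum f                                    ∎)
  where open ≡-Reasoning

sum-∘-equifibred : ∀ {N c} (g : Fin N → Fin c) (n : ℕ) → (∀ k → sum (λ z → δ (g z) k) ≡ n) →
  (F : Fin c → ℕ) → sum (λ z → F (g z)) ≡ n * sum F
sum-∘-equifibred g n fibre F = begin
  sum (λ z → F (g z))                          ≡⟨ sum-fibres g (λ z → F (g z)) ⟩
  sum (λ k → sum (λ z → δ (g z) k * F (g z)))  ≡⟨ sum-cong-≗ (λ k → sum-cong-≗ (λ z → δ-transport z k)) ⟩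
  sum (λ k → sum (λ z → δ (g z) k * F k))      ≡⟨ sum-cong-≗ (λ k → sym (*-distribʳ-sum (F k) (λ z → δ (g z) k))) ⟩
  sum (λ k → sum (λ z → δ (g z) k) * F k)      ≡⟨ sum-cong-≗ (λ k → cong (_* F k) (fibre k)) ⟩
  sum (λ k → n * F k)                          ≡⟨ sym (*-distribˡ-sum n F) ⟩
  n * sum F                                    ∎
  where
  open ≡-Reasoning
  δ-transport : ∀ z k → δ (g z) k * F (g z) ≡ δ (g z) k * F k
  δ-transport z k with g z ≟ k
  ... | yes refl = refl
  ... | no _     = refl

countFin-cong : ∀ {n} {f g : Fin n → Bool} → (∀ z → f z ≡ g z) → countFin f ≡ countFin g
countFin-cong {f = f} {g} f≗g =
  trans (countFin≡sum f) (trans (sum-cong-≗ (λ z → cong b2n (f≗g z))) (sym (countFin≡sum g)))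

countFin-allFalse : ∀ {n} (f : Fin n → Bool) → (∀ z → f z ≡ false) → countFin f ≡ 0
countFin-allFalse {n} f none =
  trans (countFin≡sum f) (trans (sum-cong-≗ (λ z → cong b2n (none z))) (trans (sum-const {n} 0) (*-zeroʳ n)))

countFin-witness : ∀ {n} (f : Fin n → Bool) → countFin f ≢ 0 → ∃[ z ] f z ≡ true
countFin-witness f ne with sum≢0⇒∃≢0 (λ z → b2n (f z)) (λ e → ne (trans (countFin≡sum f) e))
... | z , fz≢0 with f z in e
...   | true  = z , e
...   | false = ⊥-elim (fz≢0 refl)

countFin-≥1 : ∀ {n} (f : Fin n → Bool) a → f a ≡ true → 1 ≤ countFin f
countFin-≥1 f a fa = subst (1 ≤_) (sym (countFin≡sum f))
  (≤-trans (≤-reflexive (sym (sum-δ-1 a))) (sum-mono point))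
  where
  point : ∀ z → δ a z ≤ b2n (f z)
  point z with a ≟ z
  ... | yes refl = ≤-reflexive (cong b2n (sym fa))
  ... | no _     = z≤n

countFin-≥2 : ∀ {n} (f : Fin n → Bool) a b → f a ≡ true → f b ≡ true → a ≢ b → 2 ≤ countFin f
countFin-≥2 f a b fa fb a≢b = subst (2 ≤_) (sym (countFin≡sum f))
  (≤-trans (≤-reflexive (sym (trans (∑-distrib-+ (δ a) (δ b)) (cong₂ _+_ (sum-δ-1 a) (sum-δ-1 b)))))
           (sum-mono point))
  where
  point : ∀ z → δ a z + δ b z ≤ b2n (f z)
  point z with a ≟ z | b ≟ z
  ... | yes refl | yes refl = ⊥-elim (a≢b refl)
  ... | yes refl | no _     = ≤-reflexive (cong b2n (sym fa))
  ... | no _     | yes refl = ≤-reflexive (cong b2n (sym fb))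
  ... | no _     | no _     = z≤n

countFin-∧-full : ∀ {n} (f g : Fin n → Bool) → countFin (λ z → f z ∧ g z) ≡ countFin f →
  ∀ z → f z ≡ true → g z ≡ true
countFin-∧-full f g full z fz with g z in gz
... | true  = refl
... | false = ⊥-elim (1≢0 (trans (cong₂ (λ a b → b2n (a ∧ not b)) (sym fz) (sym gz))
                                 (sum≡0⇒≡0 (λ z → b2n (f z ∧ not (g z))) rest≡0 z)))
  where
  1≢0 : 1 ≢ 0
  1≢0 ()
  split : ∀ a b → b2n a ≡ b2n (a ∧ b) + b2n (a ∧ not b)
  split true  true  = refl
  split true  false = refl
  split false _     = refl
  rest≡0 : sum (λ z → b2n (f z ∧ not (g z))) ≡ 0
  rest≡0 = +-cancelˡ-≡ (countFin (λ z → f z ∧ g z)) _ _ (begin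
    countFin (λ z → f z ∧ g z) + sum (λ z → b2n (f z ∧ not (g z)))
      ≡⟨ cong (_+ sum (λ z → b2n (f z ∧ not (g z)))) (countFin≡sum (λ z → f z ∧ g z)) ⟩
    sum (λ z → b2n (f z ∧ g z)) + sum (λ z → b2n (f z ∧ not (g z)))
      ≡⟨ sym (∑-distrib-+ (λ z → b2n (f z ∧ g z)) _) ⟩
    sum (λ z → b2n (f z ∧ g z) + b2n (f z ∧ not (g z)))
      ≡⟨ sum-cong-≗ (λ z → sym (split (f z) (g z))) ⟩
    sum (λ z → b2n (f z))
      ≡⟨ sym (countFin≡sum f) ⟩
    countFin f
      ≡⟨ sym full ⟩
    countFin (λ z → f z ∧ g z)
      ≡⟨ sym (+-identityʳ _) ⟩
    countFin (λ z → f z ∧ g z) + 0 ∎)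
    where open ≡-Reasoning

countFin-∧≡sum : ∀ {n} (f g : Fin n → Bool) → countFin (λ z → f z ∧ g z) ≡ sum (λ z → b2n (f z) * b2n (g z))
countFin-∧≡sum f g = trans (countFin≡sum (λ z → f z ∧ g z)) (sum-cong-≗ (λ z → b2n-∧ (f z) (g z)))

countFin-at : ∀ {n} (i : Fin n) (f : Fin n → Bool) → countFin (λ k → ⌊ i ≟ k ⌋ ∧ f k) ≡ b2n (f i)
countFin-at i f = trans (countFin-∧≡sum (λ k → ⌊ i ≟ k ⌋) f) (sum-δ i (λ k → b2n (f k)))

countFin-atʳ : ∀ {n} (j : Fin n) (f : Fin n → Bool) → countFin (λ k → f k ∧ ⌊ k ≟ j ⌋) ≡ b2n (f j)
countFin-atʳ j f = trans (countFin-cong (λ k → ∧-comm (f k) ⌊ k ≟ j ⌋))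
  (trans (countFin-∧≡sum (λ k → ⌊ k ≟ j ⌋) f) (sum-δʳ j (λ k → b2n (f k))))

two-distinct⇒≥2 : ∀ {n} (x y : Fin n) → x ≢ y → 2 ≤ n
two-distinct⇒≥2 {suc (suc n)} _     _     _   = s≤s (s≤s z≤n)
two-distinct⇒≥2 {suc zero}    fzero fzero x≢y = ⊥-elim (x≢y refl)

three-distinct⇒≥3 : ∀ {n} (x y z : Fin n) → x ≢ y → x ≢ z → y ≢ z → 3 ≤ n
three-distinct⇒≥3 {suc (suc (suc n))} _ _ _ _ _ _ = s≤s (s≤s (s≤s z≤n))
three-distinct⇒≥3 {suc zero} fzero fzero _ x≢y _ _ = ⊥-elim (x≢y refl)
three-distinct⇒≥3 {suc (suc zero)} fzero        fzero        _            x≢y _   _   = ⊥-elim (x≢y refl)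
three-distinct⇒≥3 {suc (suc zero)} (fsuc fzero) (fsuc fzero) _            x≢y _   _   = ⊥-elim (x≢y refl)
three-distinct⇒≥3 {suc (suc zero)} fzero        (fsuc fzero) fzero        _   x≢z _   = ⊥-elim (x≢z refl)
three-distinct⇒≥3 {suc (suc zero)} fzero        (fsuc fzero) (fsuc fzero) _   _   y≢z = ⊥-elim (y≢z refl)
three-distinct⇒≥3 {suc (suc zero)} (fsuc fzero) fzero        fzero        _   _   y≢z = ⊥-elim (y≢z refl)
three-distinct⇒≥3 {suc (suc zero)} (fsuc fzero) fzero        (fsuc fzero) _   x≢z _   = ⊥-elim (x≢z refl)

-- Walks and distances

anyFin-intro : ∀ {n} (f : Fin n → Bool) (z : Fin n) → f z ≡ true → anyFin f ≡ true
anyFin-intro f fzero    fz rewrite fz = refl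
anyFin-intro f (fsuc z) fz with f fzero
... | true  = refl
... | false = anyFin-intro (λ i → f (fsuc i)) z fz

anyFin-elim : ∀ {n} (f : Fin n → Bool) → anyFin f ≡ true → ∃[ z ] f z ≡ true
anyFin-elim {suc n} f any with f fzero in f0
... | true  = fzero , f0
... | false with anyFin-elim (λ i → f (fsuc i)) any
...   | z , fz = fsuc z , fz

anyFin-allFalse : ∀ {n} (f : Fin n → Bool) → (∀ z → f z ≡ false) → anyFin f ≡ false
anyFin-allFalse {zero}  f none = refl
anyFin-allFalse {suc n} f none rewrite none fzero = anyFin-allFalse (λ i → f (fsuc i)) (λ i → none (fsuc i))

anyFin-cong : ∀ {n} {f g : Fin n → Bool} → (∀ z → f z ≡ g z) → anyFin f ≡ anyFin g
anyFin-cong {zero}  f≗g = refl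
anyFin-cong {suc n} f≗g = cong₂ _∨_ (f≗g fzero) (anyFin-cong (λ i → f≗g (fsuc i)))

anyFin-at : ∀ {n} (h : Fin n → Bool) (y : Fin n) → anyFin (λ z → h z ∧ ⌊ z ≟ y ⌋) ≡ h y
anyFin-at {suc n} h fzero with h fzero
... | true  = refl
... | false = anyFin-allFalse _ (λ z → ∧-zeroʳ (h (fsuc z)))
anyFin-at {suc n} h (fsuc y) =
  trans (cong₂ _∨_ (∧-zeroʳ (h fzero)) (anyFin-cong (λ z → cong (h (fsuc z) ∧_) (⌊suc≟suc⌋ z y))))
        (anyFin-at (λ i → h (fsuc i)) y)

firstFrom-hit : ∀ (P : ℕ → Bool) k f → firstFrom P k f < k + f → P (firstFrom P k f) ≡ true
firstFrom-hit P k zero    lt = ⊥-elim (<-irrefl (sym (+-identityʳ k)) lt)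
firstFrom-hit P k (suc f) lt with P k in e
... | true  = e
... | false = firstFrom-hit P (suc k) f (subst (firstFrom P (suc k) f <_) (+-suc k f) lt)

firstFrom-char : ∀ (P : ℕ → Bool) k f j → P j ≡ true → (∀ i → k ≤ i → i < j → P i ≡ false) →
  k ≤ j → j < k + f → firstFrom P k f ≡ j
firstFrom-char P k zero j _ _ k≤j j<k+0 = ⊥-elim (<-irrefl refl (≤-trans (subst (j <_) (+-identityʳ k) j<k+0) k≤j))
firstFrom-char P k (suc f) j Pj below k≤j j<k+f with k ℕ.≟ j | P k in e
... | yes k≡j | true  = k≡j
... | yes refl | false = ⊥-elim (true≢false (trans (sym Pj) e))
... | no k≢j  | true  = ⊥-elim (true≢false (trans (sym e) (below k ≤-refl (≤∧≢⇒< k≤j k≢j))))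
... | no k≢j  | false = firstFrom-char P (suc k) f j Pj (λ i k<i i<j → below i (≤-trans (n≤1+n k) k<i) i<j)
                          (≤∧≢⇒< k≤j k≢j) (subst (j <_) (+-suc k f) j<k+f)

module _ (Γ : Digraph) where

  dist-hit : ∀ x y → dist Γ x y < size Γ → walk Γ (dist Γ x y) x y ≡ true
  dist-hit x y = firstFrom-hit (λ k → walk Γ k x y) 0 (size Γ)

  dist-char : ∀ x y j → walk Γ j x y ≡ true → (∀ i → i < j → walk Γ i x y ≡ false) → j < size Γ →
    dist Γ x y ≡ j
  dist-char x y j w shorter = firstFrom-char (λ k → walk Γ k x y) 0 (size Γ) j w (λ i _ → shorter i) z≤n

  walk-1 : ∀ x y → walk Γ 1 x y ≡ arc Γ x y
  walk-1 x y = anyFin-at (arc Γ x) y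

  walk-2 : ∀ x y → walk Γ 2 x y ≡ anyFin (λ z → arc Γ x z ∧ arc Γ z y)
  walk-2 x y = anyFin-cong (λ z → cong (arc Γ x z ∧_) (walk-1 z y))

  walk-2-intro : ∀ {x y} z → arc Γ x z ≡ true → arc Γ z y ≡ true → walk Γ 2 x y ≡ true
  walk-2-intro z xz zy = trans (walk-2 _ _) (anyFin-intro _ z (cong₂ _∧_ xz zy))

  arc⇒≢ : ∀ {x y} → arc Γ x y ≡ true → x ≢ y
  arc⇒≢ {x} xy refl = true≢false (trans (sym xy) (loopless Γ x))

  dist-refl : ∀ x → dist Γ x x ≡ 0
  dist-refl x = dist-char x x 0 (⌊≟⌋-refl x) (λ _ ()) (nonempty x)
    where
    nonempty : ∀ {n} → Fin n → 0 < n
    nonempty {suc n} _ = s≤s z≤n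

  dist~-refl : ∀ x → dist~ Γ x x ≡ (0 , 0)
  dist~-refl x = cong₂ _,_ (dist-refl x) (dist-refl x)

  arc⇒dist≡1 : ∀ {x y} → arc Γ x y ≡ true → dist Γ x y ≡ 1
  arc⇒dist≡1 {x} {y} xy = dist-char x y 1 (trans (walk-1 x y) xy) shorter (two-distinct⇒≥2 x y (arc⇒≢ xy))
    where
    shorter : ∀ i → i < 1 → walk Γ i x y ≡ false
    shorter zero _ = ⌊≟⌋-≢ (arc⇒≢ xy)
    shorter (suc i) (s≤s ())

  dist≡1⇒arc : 2 ≤ size Γ → ∀ {x y} → dist Γ x y ≡ 1 → arc Γ x y ≡ true
  dist≡1⇒arc 2≤size {x} {y} d≡1 =
    trans (sym (walk-1 x y)) (subst (λ k → walk Γ k x y ≡ true) d≡1 (dist-hit x y (subst (_< size Γ) (sym d≡1) 2≤size)))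

  path⇒dist≡2 : ∀ {x y} z → x ≢ y → arc Γ x y ≡ false → arc Γ x z ≡ true → arc Γ z y ≡ true →
    dist Γ x y ≡ 2
  path⇒dist≡2 {x} {y} z x≢y no-xy xz zy =
    dist-char x y 2 (walk-2-intro z xz zy) shorter
      (three-distinct⇒≥3 x z y (arc⇒≢ xz) x≢y (arc⇒≢ zy))
    where
    shorter : ∀ i → i < 2 → walk Γ i x y ≡ false
    shorter zero          _ = ⌊≟⌋-≢ x≢y
    shorter (suc zero)    _ = trans (walk-1 x y) no-xy
    shorter (suc (suc i)) (s≤s (s≤s ()))

  no-digon⇒girth≥3 : (∀ {x y} → arc Γ x y ≡ true → arc Γ y x ≡ false) → GirthAtLeast Γ 3
  no-digon⇒girth≥3 no-digon (suc zero) _ _ (x , loop) =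
    true≢false (trans (sym loop) (trans (walk-1 x x) (loopless Γ x)))
  no-digon⇒girth≥3 no-digon (suc (suc zero)) _ _ (x , digon)
    with anyFin-elim (λ z → arc Γ x z ∧ arc Γ z x) (trans (sym (walk-2 x x)) digon)
  ... | z , xzx = true≢false (trans (sym (∧-conicalʳ _ _ xzx)) (no-digon (∧-conicalˡ _ _ xzx)))
  no-digon⇒girth≥3 no-digon (suc (suc (suc r))) _ (s≤s (s≤s (s≤s ())))

-- Enumerating a decidable subset of Fin N

private
  -- countFin P for P on Fin (suc N), with P fzero abstracted to b
  countWith : ℕ → Bool → ℕ
  countWith r b = (if b then 1 else 0) + r

bool-uip : ∀ {a b : Bool} (p q : a ≡ b) → p ≡ q
bool-uip = Decidable⇒UIP.≡-irrelevant _≟ᴮ_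

indexOf : ∀ {N} (P : Fin N → Bool) (x : Fin N) → P x ≡ true → Fin (countFin P)
indexOf′ : ∀ {N} (P : Fin (suc N) → Bool) (b : Bool) → P fzero ≡ b → (x : Fin (suc N)) → P x ≡ true →
  Fin (countWith (countFin (λ i → P (fsuc i))) b)

indexOf {suc N} P x Px = indexOf′ P (P fzero) refl x Px

indexOf′ P true  _   fzero    _  = fzero
indexOf′ P false P0  fzero    Px = ⊥-elim (true≢false (trans (sym Px) P0))
indexOf′ P true  _   (fsuc x) Px = fsuc (indexOf (λ i → P (fsuc i)) x Px)
indexOf′ P false _   (fsuc x) Px = indexOf (λ i → P (fsuc i)) x Px

elementAt : ∀ {N} (P : Fin N → Bool) → Fin (countFin P) → Fin N
elementAt′ : ∀ {N} (P : Fin (suc N) → Bool) (b : Bool) → Fin (countWith (countFin (λ i → P (fsuc i))) b) →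
  Fin (suc N)

elementAt {suc N} P k = elementAt′ P (P fzero) k

elementAt′ P true  fzero    = fzero
elementAt′ P true  (fsuc k) = fsuc (elementAt (λ i → P (fsuc i)) k)
elementAt′ P false k        = fsuc (elementAt (λ i → P (fsuc i)) k)

elementAt-sat : ∀ {N} (P : Fin N → Bool) (k : Fin (countFin P)) → P (elementAt P k) ≡ true
elementAt′-sat : ∀ {N} (P : Fin (suc N) → Bool) (b : Bool) → P fzero ≡ b →
  (k : Fin (countWith (countFin (λ i → P (fsuc i))) b)) → P (elementAt′ P b k) ≡ true

elementAt-sat {suc N} P k = elementAt′-sat P (P fzero) refl k

elementAt′-sat P true  P0 fzero    = P0
elementAt′-sat P true  _  (fsuc k) = elementAt-sat (λ i → P (fsuc i)) k
elementAt′-sat P false _  k        = elementAt-sat (λ i → P (fsuc i)) k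

indexOf-elementAt : ∀ {N} (P : Fin N → Bool) (k : Fin (countFin P)) (p : P (elementAt P k) ≡ true) →
  indexOf P (elementAt P k) p ≡ k
indexOf′-elementAt′ : ∀ {N} (P : Fin (suc N) → Bool) (b : Bool) (P0 : P fzero ≡ b)
  (k : Fin (countWith (countFin (λ i → P (fsuc i))) b)) (p : P (elementAt′ P b k) ≡ true) →
  indexOf′ P b P0 (elementAt′ P b k) p ≡ k

indexOf-elementAt {suc N} P k p = indexOf′-elementAt′ P (P fzero) refl k p

indexOf′-elementAt′ P true  _ fzero    _ = refl
indexOf′-elementAt′ P true  _ (fsuc k) p = cong fsuc (indexOf-elementAt (λ i → P (fsuc i)) k p)
indexOf′-elementAt′ P false _ k        p = indexOf-elementAt (λ i → P (fsuc i)) k p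

elementAt-indexOf : ∀ {N} (P : Fin N → Bool) (x : Fin N) (p : P x ≡ true) → elementAt P (indexOf P x p) ≡ x
elementAt′-indexOf′ : ∀ {N} (P : Fin (suc N) → Bool) (b : Bool) (P0 : P fzero ≡ b) (x : Fin (suc N))
  (p : P x ≡ true) → elementAt′ P b (indexOf′ P b P0 x p) ≡ x

elementAt-indexOf {suc N} P x p = elementAt′-indexOf′ P (P fzero) refl x p

elementAt′-indexOf′ P true  _  fzero    _ = refl
elementAt′-indexOf′ P false P0 fzero    p = ⊥-elim (true≢false (trans (sym p) P0))
elementAt′-indexOf′ P true  _  (fsuc x) p = cong fsuc (elementAt-indexOf (λ i → P (fsuc i)) x p)
elementAt′-indexOf′ P false _  (fsuc x) p = cong fsuc (elementAt-indexOf (λ i → P (fsuc i)) x p)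

indexOf-cong : ∀ {N} (P : Fin N → Bool) {x y : Fin N} → x ≡ y →
  {p : P x ≡ true} {q : P y ≡ true} → indexOf P x p ≡ indexOf P y q
indexOf-cong P refl {p} {q} = cong (indexOf P _) (bool-uip p q)

-- Quotient of Fin N by a Boolean equivalence relation

firstSat : ∀ {N} → (Fin N → Bool) → Maybe (Fin N)
firstSat {zero}  f = nothing
firstSat {suc N} f = if f fzero then just fzero else mapᴹ fsuc (firstSat (λ i → f (fsuc i)))

firstSat-cong : ∀ {N} {f g : Fin N → Bool} → (∀ i → f i ≡ g i) → firstSat f ≡ firstSat g
firstSat-cong {zero}  f≗g = refl
firstSat-cong {suc N} f≗g = cong₂ (λ b r → if b then just fzero else mapᴹ fsuc r)
                                  (f≗g fzero) (firstSat-cong (λ i → f≗g (fsuc i)))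

firstSat-found : ∀ {N} (f : Fin N → Bool) (x : Fin N) → f x ≡ true →
  ∃[ y ] (firstSat f ≡ just y × f y ≡ true)
firstSat-found {suc N} f x fx with f fzero in f0
... | true = fzero , refl , f0
firstSat-found {suc N} f fzero    fx | false = ⊥-elim (true≢false (trans (sym fx) f0))
firstSat-found {suc N} f (fsuc x) fx | false with firstSat-found (λ i → f (fsuc i)) x fx
... | y , first≡y , fy = fsuc y , cong (mapᴹ fsuc) first≡y , fy

record Quotient (N : ℕ) (R : Fin N → Fin N → Bool) : Set where
  field
    classes  : ℕ
    [_]      : Fin N → Fin classes
    rep      : Fin classes → Fin N
    [rep]    : ∀ k → [ rep k ] ≡ k
    sound    : ∀ x y → R x y ≡ true → [ x ] ≡ [ y ]
    complete : ∀ x y → [ x ] ≡ [ y ] → R x y ≡ true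

module _ {N : ℕ} (R : Fin N → Fin N → Bool)
  (R-refl : ∀ x → R x x ≡ true)
  (R-sym : ∀ x y → R x y ≡ true → R y x ≡ true)
  (R-trans : ∀ x y z → R x y ≡ true → R y z ≡ true → R x z ≡ true) where

  private
    least : Fin N → Fin N
    least x with firstSat (R x)
    ... | just y  = y
    ... | nothing = x  -- unreachable: x itself satisfies R x

    R-least : ∀ x → R x (least x) ≡ true
    R-least x with firstSat-found (R x) x (R-refl x)
    ... | y , first≡y , Rxy rewrite first≡y = Rxy

    R-class : ∀ x y → R x y ≡ true → ∀ z → R x z ≡ R y z
    R-class x y Rxy z = bool-ext (R-trans y x z (R-sym x y Rxy)) (R-trans x y z Rxy)

    least-cong : ∀ x y → R x y ≡ true → least x ≡ least y
    least-cong x y Rxy with firstSat (R x) in ex | firstSat (R y) in ey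
                          | firstSat-found (R x) x (R-refl x) | firstSat-found (R y) y (R-refl y)
    ... | just a | just b | _ | _ = just-injective (trans (sym ex) (trans (firstSat-cong (R-class x y Rxy)) ey))
    ... | nothing | _ | _ , () , _ | _
    ... | just _ | nothing | _ | _ , () , _

    isLeast : Fin N → Bool
    isLeast x = ⌊ least x ≟ x ⌋

    isLeast-least : ∀ x → isLeast (least x) ≡ true
    isLeast-least x = trans (cong (λ t → ⌊ t ≟ least x ⌋) (sym (least-cong x (least x) (R-least x))))
                            (⌊≟⌋-refl (least x))

    least-reflects-index : ∀ x y →
      indexOf isLeast (least x) (isLeast-least x) ≡ indexOf isLeast (least y) (isLeast-least y) → least x ≡ least y
    least-reflects-index x y e = trans (sym (elementAt-indexOf isLeast (least x) _))
      (trans (cong (elementAt isLeast) e) (elementAt-indexOf isLeast (least y) _))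

  opaque
    quotient : Quotient N R
    quotient = record
      { classes  = countFin isLeast
      ; [_]      = λ x → indexOf isLeast (least x) (isLeast-least x)
      ; rep      = elementAt isLeast
      ; [rep]    = λ k → trans (indexOf-cong isLeast (⌊≟⌋⇒≡ (elementAt-sat isLeast k)))
                               (indexOf-elementAt isLeast k (elementAt-sat isLeast k))
      ; sound    = λ x y Rxy → indexOf-cong isLeast (least-cong x y Rxy)
      ; complete = λ x y e → R-trans x (least x) y (R-least x)
                     (subst (λ t → R t y ≡ true) (sym (least-reflects-index x y e)) (R-sym y (least y) (R-least y)))
      }

-- Recognising coclique extensions
module _ (Γ Q : Digraph) (n : ℕ) (g : V Γ → V Q)
  (fibre-size : ∀ k → countFin (λ z → ⌊ g z ≟ k ⌋) ≡ n)
  (arc-factors : ∀ x y → arc Γ x y ≡ arc Q (g x) (g y)) where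

  private
    fibre : V Q → V Γ → Bool
    fibre k z = ⌊ g z ≟ k ⌋

    cast : ∀ {a b} → a ≡ b → Fin a → Fin b
    cast = subst Fin

    cast-cast : ∀ {a b} (e : a ≡ b) (r : Fin b) → cast e (cast (sym e) r) ≡ r
    cast-cast refl r = refl

    cast-cast′ : ∀ {a b} (e : a ≡ b) (r : Fin a) → cast (sym e) (cast e r) ≡ r
    cast-cast′ refl r = refl

    rank : V Γ → Fin n
    rank x = cast (fibre-size (g x)) (indexOf (fibre (g x)) x (⌊≟⌋-refl (g x)))

    unrank : V Q × Fin n → V Γ
    unrank (k , r) = elementAt (fibre k) (cast (sym (fibre-size k)) r)

    to : V Γ → Fin (size Q * n)
    to x = combine (g x) (rank x)

    from : Fin (size Q * n) → V Γ
    from u = unrank (remQuot {size Q} n u)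

    rank-at : ∀ x k (gx≡k : g x ≡ k) (p : fibre k x ≡ true) →
      rank x ≡ cast (fibre-size k) (indexOf (fibre k) x p)
    rank-at x k refl p = cong (cast (fibre-size (g x))) (cong (indexOf (fibre (g x)) x) (bool-uip _ p))

    g-unrank : ∀ k r → g (unrank (k , r)) ≡ k
    g-unrank k r = ⌊≟⌋⇒≡ (elementAt-sat (fibre k) (cast (sym (fibre-size k)) r))

    rank-unrank : ∀ k r → rank (unrank (k , r)) ≡ r
    rank-unrank k r = begin
      rank (unrank (k , r))
        ≡⟨ rank-at _ k (g-unrank k r) (elementAt-sat (fibre k) r′) ⟩
      cast (fibre-size k) (indexOf (fibre k) (elementAt (fibre k) r′) (elementAt-sat (fibre k) r′))
        ≡⟨ cong (cast (fibre-size k)) (indexOf-elementAt (fibre k) r′ _) ⟩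
      cast (fibre-size k) r′
        ≡⟨ cast-cast (fibre-size k) r ⟩
      r ∎
      where
      open ≡-Reasoning
      r′ = cast (sym (fibre-size k)) r

    to-from : ∀ u → to (from u) ≡ u
    to-from u = trans (cong₂ combine (g-unrank k r) (rank-unrank k r)) (combine-remQuot {size Q} n u)
      where
      k = proj₁ (remQuot {size Q} n u)
      r = proj₂ (remQuot {size Q} n u)

    from-to : ∀ x → from (to x) ≡ x
    from-to x = trans (cong unrank (remQuot-combine (g x) (rank x)))
      (trans (cong (elementAt (fibre (g x))) (cast-cast′ (fibre-size (g x)) _)) (elementAt-indexOf (fibre (g x)) x _))

  isomorphic-cocliqueExt : Isomorphic Γ (cocliqueExt Q n)
  isomorphic-cocliqueExt = mk↔ₛ′ to from to-from from-to , λ x y →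
    trans (arc-factors x y)
      (sym (trans (cong₂ _∨_ (cong₂ (arc Q) (g-to x) (g-to y)) (∧-zeroʳ _)) (∨-identityʳ _)))
    where
    g-to : ∀ x → fstV Q (coclique n) (to x) ≡ g x
    g-to x = cong proj₁ (remQuot-combine (g x) (rank x))

-- Arithmetic of the parameters

α-arithmetic : ∀ {m l n α L d} .{{_ : NonZero n}} → 2 ≤ m → L ≡ n * l →
  4 * (n * α) + L ≡ d + d → L + (d + d) ≡ m * L → 4 * α ≡ (m ∸ 2) * l
α-arithmetic {suc (suc k)} {l} {n} {α} {L} {d} (s≤s (s≤s _)) L≡nl 4nα+L≡2d L+2d≡mL = *-cancelˡ-≡ _ _ n (begin
  n * (4 * α)   ≡⟨ *-swap n 4 α ⟩
  4 * (n * α)   ≡⟨ +-cancelʳ-≡ L _ _ (trans 4nα+L≡2d (trans 2d≡L+kL (+-comm L (k * L)))) ⟩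
  k * L         ≡⟨ cong (k *_) L≡nl ⟩
  k * (n * l)   ≡⟨ *-swap k n l ⟩
  n * (k * l)   ∎)
  where
  open ≡-Reasoning
  *-swap : ∀ a b c → a * (b * c) ≡ b * (a * c)
  *-swap = solve-∀
  2d≡L+kL : d + d ≡ L + k * L
  2d≡L+kL = +-cancelˡ-≡ L _ _ L+2d≡mL

half-arithmetic : ∀ {m L c d} → 2 ≤ m → L + (d + d) ≡ m * L → d + c ≡ m * c → 2 * c ≡ L
half-arithmetic {suc (suc k)} {L} {c} {d} (s≤s (s≤s _)) L+2d≡mL d+c≡mc = *-cancelˡ-≡ _ _ (suc k) (begin
  suc k * (2 * c)        ≡⟨ double (suc k) c ⟩
  suc k * c + suc k * c  ≡⟨ cong₂ _+_ kc≡d kc≡d ⟩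
  d + d                  ≡⟨ +-cancelˡ-≡ L _ _ L+2d≡mL ⟩
  suc k * L              ∎)
  where
  open ≡-Reasoning
  double : ∀ a b → a * (2 * b) ≡ a * b + a * b
  double = solve-∀
  kc≡d : suc k * c ≡ d
  kc≡d = +-cancelˡ-≡ c _ _ (trans (sym d+c≡mc) (+-comm d c))

γ-arithmetic : ∀ {m l n γ L d U} .{{_ : NonZero n}} → 2 ≤ m → 1 ≤ l → L ≡ n * l → n + U ≡ L →
  2 * (n * γ * U) ≡ d * L → L + (d + d) ≡ m * L → 4 * (l ∸ 1) * γ ≡ l * l * (m ∸ 1)
γ-arithmetic {suc (suc k)} {suc l′} {n} {γ} {L} {d} {U} (s≤s (s≤s _)) (s≤s _) L≡nl n+U≡L 2nγU≡dL L+2d≡mL =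
  *-cancelˡ-≡ _ _ n (*-cancelˡ-≡ _ _ n (begin
    n * (n * (4 * l′ * γ))               ≡⟨ regroup n l′ γ ⟩
    2 * (2 * (n * γ * (n * l′)))         ≡⟨ cong (λ u → 2 * (2 * (n * γ * u))) (sym U≡nl′) ⟩
    2 * (2 * (n * γ * U))                ≡⟨ cong (2 *_) 2nγU≡dL ⟩
    2 * (d * L)                          ≡⟨ double d L ⟩
    (d + d) * L                          ≡⟨ cong (_* L) (+-cancelˡ-≡ L _ _ L+2d≡mL) ⟩
    suc k * L * L                        ≡⟨ cong (λ t → suc k * t * t) L≡nl ⟩
    suc k * (n * suc l′) * (n * suc l′)  ≡⟨ expand k n l′ ⟩
    n * (n * (suc l′ * suc l′ * suc k))  ∎))
  where
  open ≡-Reasoning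
  U≡nl′ : U ≡ n * l′
  U≡nl′ = +-cancelˡ-≡ n _ _ (trans n+U≡L (trans L≡nl (*-suc n l′)))
  regroup : ∀ n l γ → n * (n * (4 * l * γ)) ≡ 2 * (2 * (n * γ * (n * l)))
  regroup = solve-∀
  double : ∀ d L → 2 * (d * L) ≡ (d + d) * L
  double = solve-∀
  expand : ∀ k n l → suc k * (n * suc l) * (n * suc l) ≡ n * (n * (suc l * suc l * suc k))
  expand = solve-∀

-- The setting of the theorem

module Setting (Γ : Digraph) {m : ℕ} (part : V Γ → Fin m) (parts≥2 : 2 ≤ m)
  (part-size≥2 : ∀ i → 2 ≤ partSize part i) (multipartite : CompleteMultipartiteWith Γ part)
  {x₀ y₀ : V Γ} (x₀⇾y₀ : arc Γ x₀ y₀ ≡ true) (y₀↛x₀ : arc Γ y₀ x₀ ≡ false)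
  (wdr : ∀ (i j : ℕ × ℕ) (x y x′ y′ : V Γ) → dist~ Γ x y ≡ dist~ Γ x′ y′ →
     pnum Γ i j x y ≡ pnum Γ i j x′ y′)
  (comm : Commutative Γ) {q : ℕ} (T-unique : ∀ q′ → InT Γ q′ → q′ ≡ q) where

  infix 7 _⇾_
  _⇾_ : V Γ → V Γ → Bool
  x ⇾ y = arc Γ x y

  N : ℕ
  N = size Γ

  N≥2 : 2 ≤ N
  N≥2 = two-distinct⇒≥2 x₀ y₀ (arc⇒≢ Γ x₀⇾y₀)

  s : ℕ
  s = q ∸ 1

  arc⇒dist-back≡s : ∀ {x y} → x ⇾ y ≡ true → dist Γ y x ≡ s
  arc⇒dist-back≡s {x} {y} xy = cong (_∸ 1) (T-unique (suc (dist Γ y x)) (x , y , cong (_, dist Γ y x) (arc⇒dist≡1 Γ xy)))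

  s≢1 : s ≢ 1
  s≢1 s≡1 = true≢false (trans (sym (dist≡1⇒arc Γ N≥2 (trans (arc⇒dist-back≡s x₀⇾y₀) s≡1))) y₀↛x₀)

  no-digon : ∀ {x y} → x ⇾ y ≡ true → y ⇾ x ≡ false
  no-digon {x} {y} xy with y ⇾ x in yx
  ... | false = refl
  ... | true  = ⊥-elim (s≢1 (trans (sym (arc⇒dist-back≡s xy)) (arc⇒dist≡1 Γ yx)))

  dist~-arc : ∀ {x y} → x ⇾ y ≡ true → dist~ Γ x y ≡ (1 , s)
  dist~-arc xy = cong₂ _,_ (arc⇒dist≡1 Γ xy) (arc⇒dist-back≡s xy)

  dist~-arcᵀ : ∀ {x y} → y ⇾ x ≡ true → dist~ Γ x y ≡ (s , 1)
  dist~-arcᵀ yx = cong₂ _,_ (arc⇒dist-back≡s yx) (arc⇒dist≡1 Γ yx)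

  dist~≡[1,s] : ∀ x z → eqPair (dist~ Γ x z) (1 , s) ≡ x ⇾ z
  dist~≡[1,s] x z with x ⇾ z in xz
  ... | true rewrite arc⇒dist≡1 Γ xz | arc⇒dist-back≡s xz = ≡ᵇ-refl s
  ... | false with dist Γ x z ≡ᵇ 1 in d≡1
  ...   | false = refl
  ...   | true  = ⊥-elim (true≢false (trans (sym (dist≡1⇒arc Γ N≥2 (≡ᵇ-true⇒≡ _ _ d≡1))) xz))

  dist~≡[s,1] : ∀ x z → eqPair (dist~ Γ x z) (s , 1) ≡ z ⇾ x
  dist~≡[s,1] x z with z ⇾ x in zx
  ... | true rewrite arc⇒dist≡1 Γ zx | arc⇒dist-back≡s zx = cong (_∧ true) (≡ᵇ-refl s)
  ... | false with dist Γ z x ≡ᵇ 1 in d≡1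
  ...   | false = ∧-zeroʳ _
  ...   | true  = ⊥-elim (true≢false (trans (sym (dist≡1⇒arc Γ N≥2 (≡ᵇ-true⇒≡ _ _ d≡1))) zx))

  paths₂ commonOut : V Γ → V Γ → ℕ
  paths₂ x y    = countFin (λ z → x ⇾ z ∧ z ⇾ y)
  commonOut x y = countFin (λ z → x ⇾ z ∧ y ⇾ z)

  outInto : V Γ → Fin m → ℕ
  outInto x p = countFin (λ z → x ⇾ z ∧ ⌊ part z ≟ p ⌋)

  pnum≡paths₂ : ∀ x y → pnum Γ (1 , s) (1 , s) x y ≡ paths₂ x y
  pnum≡paths₂ x y = countFin-cong (λ z → cong₂ _∧_ (dist~≡[1,s] x z) (dist~≡[1,s] z y))

  pnum≡commonOut : ∀ x y → pnum Γ (1 , s) (s , 1) x y ≡ commonOut x y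
  pnum≡commonOut x y = countFin-cong (λ z → cong₂ _∧_ (dist~≡[1,s] x z) (dist~≡[s,1] z y))

  paths₂-wdr : ∀ {x y x′ y′} → dist~ Γ x y ≡ dist~ Γ x′ y′ → paths₂ x y ≡ paths₂ x′ y′
  paths₂-wdr {x} {y} {x′} {y′} e = trans (sym (pnum≡paths₂ x y)) (trans (wdr _ _ x y x′ y′ e) (pnum≡paths₂ x′ y′))

  commonOut-wdr : ∀ {x y x′ y′} → dist~ Γ x y ≡ dist~ Γ x′ y′ → commonOut x y ≡ commonOut x′ y′
  commonOut-wdr {x} {y} {x′} {y′} e =
    trans (sym (pnum≡commonOut x y)) (trans (wdr _ _ x y x′ y′ e) (pnum≡commonOut x′ y′))

  commonOut-sym : ∀ x y → commonOut x y ≡ commonOut y x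
  commonOut-sym x y = countFin-cong (λ z → ∧-comm (x ⇾ z) (y ⇾ z))

  d : ℕ
  d = outdeg Γ x₀

  pnum≡outdeg : ∀ x → pnum Γ (1 , s) (s , 1) x x ≡ outdeg Γ x
  pnum≡outdeg x = trans (pnum≡commonOut x x) (countFin-cong (λ z → ∧-idem (x ⇾ z)))

  pnum≡indeg : ∀ x → pnum Γ (s , 1) (1 , s) x x ≡ indeg Γ x
  pnum≡indeg x = countFin-cong (λ z → trans (cong₂ _∧_ (dist~≡[s,1] x z) (dist~≡[1,s] z x)) (∧-idem (z ⇾ x)))

  outdeg≡d : ∀ x → outdeg Γ x ≡ d
  outdeg≡d x = trans (sym (pnum≡outdeg x))
    (trans (wdr _ _ x x x₀ x₀ (trans (dist~-refl Γ x) (sym (dist~-refl Γ x₀)))) (pnum≡outdeg x₀))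

  -- commutativity turns the out-degree into the in-degree
  indeg≡d : ∀ x → indeg Γ x ≡ d
  indeg≡d x = trans (sym (pnum≡indeg x)) (trans (sym (comm _ _ x x)) (trans (pnum≡outdeg x) (outdeg≡d x)))

  samePart : V Γ → V Γ → Bool
  samePart x z = ⌊ part z ≟ part x ⌋

  arc⇒part≢ : ∀ {x z} → x ⇾ z ≡ true → part z ≢ part x
  arc⇒part≢ {x} {z} xz pz≡px = proj₁ (multipartite x z) (cong (_∨ z ⇾ x) xz) (sym pz≡px)

  part≢⇒adj : ∀ {x z} → part x ≢ part z → (x ⇾ z ∨ z ⇾ x) ≡ true
  part≢⇒adj {x} {z} = proj₂ (multipartite x z)

  part≡⇒no-arc : ∀ {x z} → part x ≡ part z → x ⇾ z ≡ false
  part≡⇒no-arc {x} {z} px≡pz with x ⇾ z in xz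
  ... | false = refl
  ... | true  = ⊥-elim (arc⇒part≢ xz (sym px≡pz))

  trichotomy : ∀ x z → b2n (samePart x z) + b2n (x ⇾ z) + b2n (z ⇾ x) ≡ 1
  trichotomy x z with part z ≟ part x | x ⇾ z in xz | z ⇾ x in zx
  ... | yes pz≡px | true  | _     = ⊥-elim (arc⇒part≢ xz pz≡px)
  ... | yes pz≡px | false | true  = ⊥-elim (arc⇒part≢ zx (sym pz≡px))
  ... | yes _     | false | false = refl
  ... | no _      | true  | true  = ⊥-elim (true≢false (trans (sym zx) (no-digon xz)))
  ... | no _      | true  | false = refl
  ... | no _      | false | true  = refl
  ... | no pz≢px  | false | false =
    ⊥-elim (true≢false (trans (sym (part≢⇒adj (λ e → pz≢px (sym e)))) (cong₂ _∨_ xz zx)))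

  arcᵀ-determined : ∀ x z → z ⇾ x ≡ not (samePart x z ∨ x ⇾ z)
  arcᵀ-determined x z with part z ≟ part x | x ⇾ z in xz | z ⇾ x in zx
  ... | yes pz≡px | _     | true  = ⊥-elim (arc⇒part≢ zx (sym pz≡px))
  ... | yes _     | _     | false = refl
  ... | no _      | true  | true  = ⊥-elim (true≢false (trans (sym zx) (no-digon xz)))
  ... | no _      | true  | false = refl
  ... | no _      | false | true  = refl
  ... | no pz≢px  | false | false =
    ⊥-elim (true≢false (trans (sym (part≢⇒adj (λ e → pz≢px (sym e)))) (cong₂ _∨_ xz zx)))

  partSize+2d : ∀ x → partSize part (part x) + (d + d) ≡ N
  partSize+2d x = begin
    partSize part (part x) + (d + d)
      ≡⟨ sym (+-assoc (partSize part (part x)) d d) ⟩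
    partSize part (part x) + d + d
      ≡⟨ cong₂ (λ a b → partSize part (part x) + a + b) (sym (outdeg≡d x)) (sym (indeg≡d x)) ⟩
    countFin (samePart x) + countFin (x ⇾_) + countFin (_⇾ x)
      ≡⟨ cong₂ _+_ (cong₂ _+_ (countFin≡sum (samePart x)) (countFin≡sum (x ⇾_))) (countFin≡sum (_⇾ x)) ⟩
    sum (λ z → b2n (samePart x z)) + sum (λ z → b2n (x ⇾ z)) + sum (λ z → b2n (z ⇾ x))
      ≡⟨ sym (∑-distrib-+₃ (λ z → b2n (samePart x z)) (λ z → b2n (x ⇾ z)) (λ z → b2n (z ⇾ x))) ⟩
    sum (λ z → b2n (samePart x z) + b2n (x ⇾ z) + b2n (z ⇾ x))
      ≡⟨ sum-cong-≗ (trichotomy x) ⟩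
    sum {N} (λ _ → 1)
      ≡⟨ trans (sum-const {N} 1) (*-identityʳ N) ⟩
    N ∎
    where open ≡-Reasoning

  L : ℕ
  L = partSize part (part x₀)

  instance
    L-nonZero : NonZero L
    L-nonZero = >-nonZero (≤-trans (s≤s z≤n) (part-size≥2 (part x₀)))

  opaque
    member-of : ∀ p → ∃[ x ] ⌊ part x ≟ p ⌋ ≡ true
    member-of p = countFin-witness (λ x → ⌊ part x ≟ p ⌋) (λ e → 2≰0 (subst (2 ≤_) e (part-size≥2 p)))
      where
      2≰0 : ¬ 2 ≤ 0
      2≰0 ()

  member : Fin m → V Γ
  member p = proj₁ (member-of p)

  part-member : ∀ p → part (member p) ≡ p
  part-member p = ⌊≟⌋⇒≡ (proj₂ (member-of p))

  partSize≡L : ∀ p → partSize part p ≡ L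
  partSize≡L p = +-cancelʳ-≡ (d + d) _ _
    (trans (subst (λ t → partSize part t + (d + d) ≡ N) (part-member p) (partSize+2d (member p)))
           (sym (partSize+2d x₀)))

  sum-δ-part : ∀ p → sum (λ z → δ (part z) p) ≡ L
  sum-δ-part p = trans (sym (countFin≡sum (λ z → ⌊ part z ≟ p ⌋))) (partSize≡L p)

  out-decomposition : ∀ x y → commonOut x y + paths₂ x y + outInto x (part y) ≡ d
  out-decomposition x y = begin
    commonOut x y + paths₂ x y + outInto x (part y)
      ≡⟨ cong₂ _+_ (cong₂ _+_ (countFin≡sum (λ z → x ⇾ z ∧ y ⇾ z)) (countFin≡sum (λ z → x ⇾ z ∧ z ⇾ y)))
                   (countFin≡sum (λ z → x ⇾ z ∧ samePart y z)) ⟩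
    sum (λ z → b2n (x ⇾ z ∧ y ⇾ z)) + sum (λ z → b2n (x ⇾ z ∧ z ⇾ y)) + sum (λ z → b2n (x ⇾ z ∧ samePart y z))
      ≡⟨ sym (∑-distrib-+₃ (λ z → b2n (x ⇾ z ∧ y ⇾ z)) (λ z → b2n (x ⇾ z ∧ z ⇾ y))
                           (λ z → b2n (x ⇾ z ∧ samePart y z))) ⟩
    sum (λ z → b2n (x ⇾ z ∧ y ⇾ z) + b2n (x ⇾ z ∧ z ⇾ y) + b2n (x ⇾ z ∧ samePart y z))
      ≡⟨ sum-cong-≗ (λ z → sym (split (x ⇾ z) (samePart y z) (y ⇾ z) (z ⇾ y) (trichotomy y z))) ⟩
    sum (λ z → b2n (x ⇾ z))
      ≡⟨ sym (countFin≡sum (x ⇾_)) ⟩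
    outdeg Γ x
      ≡⟨ outdeg≡d x ⟩
    d ∎
    where
    open ≡-Reasoning
    split : ∀ a b c e → b2n b + b2n c + b2n e ≡ 1 → b2n a ≡ b2n (a ∧ c) + b2n (a ∧ e) + b2n (a ∧ b)
    split false _     _     _     _ = refl
    split true  true  false false _ = refl
    split true  false true  false _ = refl
    split true  false false true  _ = refl
    split true  false false false ()
    split true  true  true  _     ()
    split true  true  false true  ()
    split true  false true  true  ()

  outInto-own-part : ∀ x p → part x ≡ p → outInto x p ≡ 0
  outInto-own-part x p px≡p = countFin-allFalse (λ z → x ⇾ z ∧ ⌊ part z ≟ p ⌋) λ z →
    ∧-exclusive (λ xz → ⌊≟⌋-≢ (λ pz≡p → arc⇒part≢ xz (trans pz≡p (sym px≡p))))

  same-part-decomposition : ∀ x y → part x ≡ part y → commonOut x y + paths₂ x y ≡ d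
  same-part-decomposition x y px≡py =
    trans (sym (+-identityʳ _)) (trans (cong (commonOut x y + paths₂ x y +_) (sym (outInto-own-part x (part y) px≡py)))
                                       (out-decomposition x y))

  paths₂-sym-same-part : ∀ x y → part x ≡ part y → paths₂ x y ≡ paths₂ y x
  paths₂-sym-same-part x y px≡py = +-cancelˡ-≡ (commonOut x y) _ _
    (trans (same-part-decomposition x y px≡py)
           (sym (trans (cong (_+ paths₂ y x) (commonOut-sym x y)) (same-part-decomposition y x (sym px≡py)))))

  Twin : V Γ → V Γ → Set
  Twin x y = ∀ z → x ⇾ z ≡ y ⇾ z

  commonOut≡d⇒⊆ : ∀ x y → commonOut x y ≡ d → ∀ z → x ⇾ z ≡ true → y ⇾ z ≡ true
  commonOut≡d⇒⊆ x y full = countFin-∧-full (x ⇾_) (y ⇾_) (trans full (sym (outdeg≡d x)))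

  paths₂≡0⇒twin : ∀ x y → part x ≡ part y → paths₂ x y ≡ 0 → Twin x y
  paths₂≡0⇒twin x y px≡py none z =
    bool-ext (commonOut≡d⇒⊆ x y (full x y px≡py none) z)
             (commonOut≡d⇒⊆ y x (full y x (sym px≡py) (trans (sym (paths₂-sym-same-part x y px≡py)) none)) z)
    where
    full : ∀ x y → part x ≡ part y → paths₂ x y ≡ 0 → commonOut x y ≡ d
    full x y px≡py none = trans (sym (+-identityʳ _))
      (trans (cong (commonOut x y +_) (sym none)) (same-part-decomposition x y px≡py))

  twin⇒paths₂≡0 : ∀ x y → Twin x y → paths₂ x y ≡ 0
  twin⇒paths₂≡0 x y twin =
    countFin-allFalse (λ z → x ⇾ z ∧ z ⇾ y) λ z → ∧-exclusive (λ xz → no-digon (trans (sym (twin z)) xz))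

  twin⇒same-in : ∀ x y → part x ≡ part y → Twin x y → ∀ z → z ⇾ x ≡ z ⇾ y
  twin⇒same-in x y px≡py twin z = begin
    z ⇾ x                             ≡⟨ arcᵀ-determined x z ⟩
    not (⌊ part z ≟ part x ⌋ ∨ x ⇾ z)  ≡⟨ cong₂ (λ p b → not (⌊ part z ≟ p ⌋ ∨ b)) px≡py (twin z) ⟩
    not (⌊ part z ≟ part y ⌋ ∨ y ⇾ z)  ≡⟨ sym (arcᵀ-determined y z) ⟩
    z ⇾ y                             ∎
    where open ≡-Reasoning

  twin-arc-cong : ∀ {x x′ y y′} → part x ≡ part x′ → Twin x x′ → part y ≡ part y′ → Twin y y′ →
    x ⇾ y ≡ x′ ⇾ y′
  twin-arc-cong {x} {x′} {y} {y′} _ twin-x py≡py′ twin-y = trans (twin-x y) (twin⇒same-in y y′ py≡py′ twin-y x′)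

  arcᵀ⇒paths₂≢0 : ∀ x y → y ⇾ x ≡ true → outInto x (part y) ≡ 0 → paths₂ x y ≢ 0
  arcᵀ⇒paths₂≢0 x y yx none-in-part no-path =
    true≢false (trans (sym (commonOut≡d⇒⊆ y x full x yx)) (loopless Γ x))
    where
    full : commonOut y x ≡ d
    full = trans (commonOut-sym y x) (trans (sym (trans (+-identityʳ _) (+-identityʳ _)))
      (trans (cong₂ (λ u v → commonOut x y + u + v) (sym no-path) (sym none-in-part)) (out-decomposition x y)))

  module AllTwins (all-twins : ∀ x y → part x ≡ part y → paths₂ x y ≡ 0) where

    same-part⇒twin : ∀ {x y} → part x ≡ part y → Twin x y
    same-part⇒twin {x} {y} px≡py = paths₂≡0⇒twin x y px≡py (all-twins x y px≡py)

    Q : Digraph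
    Q = record { size = m ; arc = λ i j → member i ⇾ member j ; loopless = λ i → loopless Γ (member i) }

    arc-factors : ∀ x y → x ⇾ y ≡ arc Q (part x) (part y)
    arc-factors x y = twin-arc-cong (sym (part-member _)) (same-part⇒twin (sym (part-member _)))
                                    (sym (part-member _)) (same-part⇒twin (sym (part-member _)))

    Γ≅Q[L] : Isomorphic Γ (cocliqueExt Q L)
    Γ≅Q[L] = isomorphic-cocliqueExt Γ Q L part partSize≡L arc-factors

    semicomplete : Semicomplete Q
    semicomplete i j i≢j = part≢⇒adj (λ e → i≢j (trans (sym (part-member i)) (trans e (part-member j))))

    arcᵀ⇒no-out-into : ∀ x y → y ⇾ x ≡ true → outInto x (part y) ≡ 0
    arcᵀ⇒no-out-into x y yx =
      countFin-allFalse (λ z → x ⇾ z ∧ ⌊ part z ≟ part y ⌋) λ z → ∧-exclusive λ xz → ⌊≟⌋-≢ λ pz≡py →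
      true≢false (trans (sym (trans (same-part⇒twin pz≡py x) yx)) (no-digon xz))

    arcᵀ⇒path₂ : ∀ x y → y ⇾ x ≡ true → ∃[ z ] (x ⇾ z ≡ true × z ⇾ y ≡ true)
    arcᵀ⇒path₂ x y yx with countFin-witness _ (arcᵀ⇒paths₂≢0 x y yx (arcᵀ⇒no-out-into x y yx))
    ... | z , xzy = z , ∧-conicalˡ _ _ xzy , ∧-conicalʳ _ _ xzy

    s≡2 : s ≡ 2
    s≡2 = let z , y₀z , zx₀ = arcᵀ⇒path₂ y₀ x₀ x₀⇾y₀ in
      trans (sym (arc⇒dist-back≡s x₀⇾y₀)) (path⇒dist≡2 Γ z (arc⇒≢ Γ x₀⇾y₀ ∘ sym) y₀↛x₀ y₀z zx₀)

    infix 7 _⇾Q_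
    _⇾Q_ : Fin m → Fin m → Bool
    i ⇾Q j = arc Q i j

    member⇾ : ∀ i z → member i ⇾ z ≡ i ⇾Q part z
    member⇾ i z = trans (arc-factors (member i) z) (cong (_⇾Q part z) (part-member i))

    ⇾member : ∀ z j → z ⇾ member j ≡ part z ⇾Q j
    ⇾member z j = trans (arc-factors z (member j)) (cong (part z ⇾Q_) (part-member j))

    no-digonQ : ∀ {i j} → i ⇾Q j ≡ true → j ⇾Q i ≡ false
    no-digonQ = no-digon

    Q-tournament : ∀ {i j} → i ≢ j → i ⇾Q j ≡ false → j ⇾Q i ≡ true
    Q-tournament {i} {j} i≢j ij = trans (sym (cong (_∨ j ⇾Q i) ij)) (semicomplete i j i≢j)

    arcᵀ⇒pathQ : ∀ i j → j ⇾Q i ≡ true → ∃[ w ] (i ⇾Q w ≡ true × w ⇾Q j ≡ true)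
    arcᵀ⇒pathQ i j ji =
      let z , iz , zj = arcᵀ⇒path₂ (member i) (member j) ji
      in part z , trans (sym (member⇾ i z)) iz , trans (sym (⇾member z j)) zj

    arcᵀ⇒distQ≡2 : ∀ {i j} → j ⇾Q i ≡ true → dist Q i j ≡ 2
    arcᵀ⇒distQ≡2 {i} {j} ji =
      let w , iw , wj = arcᵀ⇒pathQ i j ji in path⇒dist≡2 Q w (arc⇒≢ Q ji ∘ sym) (no-digonQ ji) iw wj

    kind : Fin 3 → Fin m → Fin m → Bool
    kind fzero               i k = ⌊ i ≟ k ⌋
    kind (fsuc fzero)        i k = i ⇾Q k
    kind (fsuc (fsuc fzero)) i k = k ⇾Q i

    kindDist : Fin 3 → ℕ × ℕ
    kindDist fzero               = (0 , 0)
    kindDist (fsuc fzero)        = (1 , 2)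
    kindDist (fsuc (fsuc fzero)) = (2 , 1)

    kindDist-injective : ∀ {a b} → kindDist a ≡ kindDist b → a ≡ b
    kindDist-injective {fzero}               {fzero}               _ = refl
    kindDist-injective {fsuc fzero}          {fsuc fzero}          _ = refl
    kindDist-injective {fsuc (fsuc fzero)}   {fsuc (fsuc fzero)}   _ = refl
    kindDist-injective {fzero}               {fsuc fzero}          ()
    kindDist-injective {fzero}               {fsuc (fsuc fzero)}   ()
    kindDist-injective {fsuc fzero}          {fzero}               ()
    kindDist-injective {fsuc fzero}          {fsuc (fsuc fzero)}   ()
    kindDist-injective {fsuc (fsuc fzero)}   {fzero}               ()
    kindDist-injective {fsuc (fsuc fzero)}   {fsuc fzero}          ()

    kindOf : Fin m → Fin m → Fin 3
    kindOf i k = if ⌊ i ≟ k ⌋ then fzero else if i ⇾Q k then fsuc fzero else fsuc (fsuc fzero)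

    kind≡kindOf : ∀ a i k → kind a i k ≡ ⌊ kindOf i k ≟ a ⌋
    kind≡kindOf a i k with i ≟ k | i ⇾Q k in ik
    kind≡kindOf fzero               i .i | yes refl | _ = ⌊≟⌋-refl i
    kind≡kindOf (fsuc fzero)        i .i | yes refl | _ = loopless Q i
    kind≡kindOf (fsuc (fsuc fzero)) i .i | yes refl | _ = loopless Q i
    kind≡kindOf fzero               i k  | no i≢k | true  = ⌊≟⌋-≢ i≢k
    kind≡kindOf fzero               i k  | no i≢k | false = ⌊≟⌋-≢ i≢k
    kind≡kindOf (fsuc fzero)        i k  | no _   | true  = ik
    kind≡kindOf (fsuc (fsuc fzero)) i k  | no _   | true  = no-digonQ ik
    kind≡kindOf (fsuc fzero)        i k  | no _   | false = ik
    kind≡kindOf (fsuc (fsuc fzero)) i k  | no i≢k | false = Q-tournament i≢k ik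

    dist~Q≡kindDist : ∀ i k → dist~ Q i k ≡ kindDist (kindOf i k)
    dist~Q≡kindDist i k with i ≟ k | i ⇾Q k in ik
    ... | yes refl | _     = dist~-refl Q i
    ... | no _     | true  = cong₂ _,_ (arc⇒dist≡1 Q ik) (arcᵀ⇒distQ≡2 ik)
    ... | no i≢k   | false = cong₂ _,_ (arcᵀ⇒distQ≡2 (Q-tournament i≢k ik)) (arc⇒dist≡1 Q (Q-tournament i≢k ik))

    dist~Γ≡kindDist : ∀ i k → dist~ Γ (member i) (member k) ≡ kindDist (kindOf i k)
    dist~Γ≡kindDist i k with i ≟ k | i ⇾Q k in ik
    ... | yes refl | _     = dist~-refl Γ (member i)
    ... | no _     | true  = trans (dist~-arc ik) (cong (1 ,_) s≡2)
    ... | no i≢k   | false = trans (dist~-arcᵀ (Q-tournament i≢k ik)) (cong (_, 1) s≡2)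

    kindOf-wdr : ∀ {i j i′ j′} → dist~ Q i j ≡ dist~ Q i′ j′ → kindOf i j ≡ kindOf i′ j′
    kindOf-wdr {i} {j} {i′} {j′} e =
      kindDist-injective (trans (sym (dist~Q≡kindDist i j)) (trans e (dist~Q≡kindDist i′ j′)))

    -- Q is a tournament of diameter 2, so its distance relations are I, A and Aᵀ (the kinds 0, 1, 2); every
    -- intersection number of Q is thus a combination of entries of their products, and those lift to Γ.
    weight : ℕ × ℕ → Fin 3 → ℕ
    weight I a = b2n (eqPair (kindDist a) I)

    indicator-expansion : ∀ I i k → b2n (eqPair (dist~ Q i k) I) ≡ sum (λ a → weight I a * b2n (kind a i k))
    indicator-expansion I i k = begin
      b2n (eqPair (dist~ Q i k) I)                         ≡⟨ cong (λ D → b2n (eqPair D I)) (dist~Q≡kindDist i k) ⟩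
      weight I (kindOf i k)                                ≡⟨ sym (sum-δ (kindOf i k) (weight I)) ⟩
      sum (λ a → δ (kindOf i k) a * weight I a)            ≡⟨ sum-cong-≗ (λ a → *-comm (δ (kindOf i k) a) (weight I a)) ⟩
      sum (λ a → weight I a * b2n ⌊ kindOf i k ≟ a ⌋)
        ≡⟨ sum-cong-≗ (λ a → cong (λ b → weight I a * b2n b) (sym (kind≡kindOf a i k))) ⟩
      sum (λ a → weight I a * b2n (kind a i k))            ∎
      where open ≡-Reasoning

    kindProduct : Fin 3 → Fin 3 → Fin m → Fin m → ℕ
    kindProduct a b i j = countFin (λ k → kind a i k ∧ kind b k j)

    pnumQ-expansion : ∀ I J i j →
      pnum Q I J i j ≡ sum (λ a → sum (λ b → weight I a * weight J b * kindProduct a b i j))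
    pnumQ-expansion I J i j = begin
      pnum Q I J i j
        ≡⟨ countFin-∧≡sum (λ k → eqPair (dist~ Q i k) I) (λ k → eqPair (dist~ Q k j) J) ⟩
      sum (λ k → b2n (eqPair (dist~ Q i k) I) * b2n (eqPair (dist~ Q k j) J))
        ≡⟨ sum-cong-≗ (λ k → cong₂ _*_ (indicator-expansion I i k) (indicator-expansion J k j)) ⟩
      sum (λ k → sum (λ a → weight I a * b2n (kind a i k)) * sum (λ b → weight J b * b2n (kind b k j)))
        ≡⟨ sum-product-expansion (weight I) (λ a k → b2n (kind a i k)) (weight J) (λ b k → b2n (kind b k j)) ⟩
      sum (λ a → sum (λ b → weight I a * weight J b * sum (λ k → b2n (kind a i k) * b2n (kind b k j))))
        ≡⟨ sum-cong-≗ (λ a → sum-cong-≗ (λ b → cong (weight I a * weight J b *_)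
                                                     (sym (countFin-∧≡sum (kind a i) (λ k → kind b k j))))) ⟩
      sum (λ a → sum (λ b → weight I a * weight J b * kindProduct a b i j)) ∎
      where open ≡-Reasoning

    arcKind-lift : ∀ a i z → eqPair (dist~ Γ (member i) z) (kindDist (fsuc a)) ≡ kind (fsuc a) i (part z)
    arcKind-lift fzero        i z = trans (subst (λ t → eqPair (dist~ Γ (member i) z) (1 , t) ≡ member i ⇾ z) s≡2
                                                 (dist~≡[1,s] (member i) z))
                                          (member⇾ i z)
    arcKind-lift (fsuc fzero) i z = trans (subst (λ t → eqPair (dist~ Γ (member i) z) (t , 1) ≡ z ⇾ member i) s≡2
                                                 (dist~≡[s,1] (member i) z))
                                          (⇾member z i)

    arcKind-liftʳ : ∀ b z j → eqPair (dist~ Γ z (member j)) (kindDist (fsuc b)) ≡ kind (fsuc b) (part z) j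
    arcKind-liftʳ fzero        z j = trans (subst (λ t → eqPair (dist~ Γ z (member j)) (1 , t) ≡ z ⇾ member j) s≡2
                                                  (dist~≡[1,s] z (member j)))
                                           (⇾member z j)
    arcKind-liftʳ (fsuc fzero) z j = trans (subst (λ t → eqPair (dist~ Γ z (member j)) (t , 1) ≡ member j ⇾ z) s≡2
                                                  (dist~≡[s,1] z (member j)))
                                           (member⇾ j z)

    -- each vertex of Q stands for a part of L vertices of Γ
    kindProduct-lift : ∀ a b i j →
      pnum Γ (kindDist (fsuc a)) (kindDist (fsuc b)) (member i) (member j) ≡ L * kindProduct (fsuc a) (fsuc b) i j
    kindProduct-lift a b i j = begin
      pnum Γ (kindDist (fsuc a)) (kindDist (fsuc b)) (member i) (member j)
        ≡⟨ countFin-cong (λ z → cong₂ _∧_ (arcKind-lift a i z) (arcKind-liftʳ b z j)) ⟩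
      countFin (λ z → F (part z))
        ≡⟨ countFin≡sum (λ z → F (part z)) ⟩
      sum (λ z → b2n (F (part z)))
        ≡⟨ sum-∘-equifibred part L sum-δ-part (λ k → b2n (F k)) ⟩
      L * sum (λ k → b2n (F k))
        ≡⟨ cong (L *_) (sym (countFin≡sum F)) ⟩
      L * kindProduct (fsuc a) (fsuc b) i j ∎
      where
      open ≡-Reasoning
      F : Fin m → Bool
      F k = kind (fsuc a) i k ∧ kind (fsuc b) k j

    kindProduct-wdr : ∀ a b {i j i′ j′} → kindOf i j ≡ kindOf i′ j′ → kindProduct a b i j ≡ kindProduct a b i′ j′
    kindProduct-wdr fzero b {i} {j} {i′} {j′} e = begin
      kindProduct fzero b i j    ≡⟨ countFin-at i (λ k → kind b k j) ⟩
      b2n (kind b i j)           ≡⟨ cong b2n (trans (kind≡kindOf b i j) (cong (λ c → ⌊ c ≟ b ⌋) e)) ⟩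
      b2n ⌊ kindOf i′ j′ ≟ b ⌋    ≡⟨ cong b2n (sym (kind≡kindOf b i′ j′)) ⟩
      b2n (kind b i′ j′)         ≡⟨ sym (countFin-at i′ (λ k → kind b k j′)) ⟩
      kindProduct fzero b i′ j′  ∎
      where open ≡-Reasoning
    kindProduct-wdr (fsuc a) fzero {i} {j} {i′} {j′} e = begin
      kindProduct (fsuc a) fzero i j    ≡⟨ countFin-atʳ j (kind (fsuc a) i) ⟩
      b2n (kind (fsuc a) i j)           ≡⟨ cong b2n (trans (kind≡kindOf (fsuc a) i j) (cong (λ c → ⌊ c ≟ fsuc a ⌋) e)) ⟩
      b2n ⌊ kindOf i′ j′ ≟ fsuc a ⌋      ≡⟨ cong b2n (sym (kind≡kindOf (fsuc a) i′ j′)) ⟩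
      b2n (kind (fsuc a) i′ j′)         ≡⟨ sym (countFin-atʳ j′ (kind (fsuc a) i′)) ⟩
      kindProduct (fsuc a) fzero i′ j′  ∎
      where open ≡-Reasoning
    kindProduct-wdr (fsuc a) (fsuc b) {i} {j} {i′} {j′} e = *-cancelˡ-≡ _ _ L (begin
      L * kindProduct (fsuc a) (fsuc b) i j
        ≡⟨ sym (kindProduct-lift a b i j) ⟩
      pnum Γ (kindDist (fsuc a)) (kindDist (fsuc b)) (member i) (member j)
        ≡⟨ wdr _ _ _ _ _ _ (trans (dist~Γ≡kindDist i j) (trans (cong kindDist e) (sym (dist~Γ≡kindDist i′ j′)))) ⟩
      pnum Γ (kindDist (fsuc a)) (kindDist (fsuc b)) (member i′) (member j′)
        ≡⟨ kindProduct-lift a b i′ j′ ⟩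
      L * kindProduct (fsuc a) (fsuc b) i′ j′ ∎)
      where open ≡-Reasoning

    wdrQ : ∀ (I J : ℕ × ℕ) (i j i′ j′ : Fin m) → dist~ Q i j ≡ dist~ Q i′ j′ → pnum Q I J i j ≡ pnum Q I J i′ j′
    wdrQ I J i j i′ j′ e = trans (pnumQ-expansion I J i j) (trans
      (sum-cong-≗ λ a → sum-cong-≗ λ b →
        cong (weight I a * weight J b *_) (kindProduct-wdr a b {i} {j} {i′} {j′} (kindOf-wdr e)))
      (sym (pnumQ-expansion I J i′ j′)))

    x₀⇾Qy₀ : part x₀ ⇾Q part y₀ ≡ true
    x₀⇾Qy₀ = trans (sym (arc-factors x₀ y₀)) x₀⇾y₀

    nonsymmetricQ : NonSymmetric Q
    nonsymmetricQ = part x₀ , part y₀ , x₀⇾Qy₀ , trans (sym (arc-factors y₀ x₀)) y₀↛x₀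

    strongly-connectedQ : StronglyConnected Q
    strongly-connectedQ i j with i ≟ j | i ⇾Q j in ij
    ... | yes refl | _     = 0 , ⌊≟⌋-refl i
    ... | no _     | true  = 1 , trans (walk-1 Q i j) ij
    ... | no i≢j   | false = let w , iw , wj = arcᵀ⇒pathQ i j (Q-tournament i≢j ij) in 2 , walk-2-intro Q w iw wj

    girthQ≡3 : Girth Q 3
    girthQ≡3 = triangle , no-digon⇒girth≥3 Q no-digonQ
      where
      triangle : HasCircuit Q 3
      triangle = let w , y₀w , wx₀ = arcᵀ⇒pathQ (part y₀) (part x₀) x₀⇾Qy₀
                 in part x₀ , anyFin-intro _ (part y₀) (cong₂ _∧_ x₀⇾Qy₀ (walk-2-intro Q w y₀w wx₀))

    caseA : CaseA Γ
    caseA = Q , L , part-size≥2 (part x₀) , semicomplete , (nonsymmetricQ , strongly-connectedQ , wdrQ) ,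
            inj₂ girthQ≡3 , Γ≅Q[L]

  module TwinQuotient {x₁ y₁ : V Γ} (x₁∼y₁ : part x₁ ≡ part y₁) (paths₂x₁y₁≢0 : paths₂ x₁ y₁ ≢ 0) where

    outInto-wdr : ∀ {x y x′ y′} → dist~ Γ x y ≡ dist~ Γ x′ y′ → outInto x (part y) ≡ outInto x′ (part y′)
    outInto-wdr {x} {y} {x′} {y′} e = +-cancelˡ-≡ (commonOut x y + paths₂ x y) _ _
      (trans (out-decomposition x y)
             (sym (trans (cong₂ (λ u v → u + v + outInto x′ (part y′)) (commonOut-wdr e) (paths₂-wdr e))
                         (out-decomposition x′ y′))))

    c c′ : ℕ
    c  = outInto x₀ (part y₀)
    c′ = outInto y₀ (part x₀)

    outInto-arc : ∀ {x y} → x ⇾ y ≡ true → outInto x (part y) ≡ c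
    outInto-arc xy = outInto-wdr (trans (dist~-arc xy) (sym (dist~-arc x₀⇾y₀)))

    outInto-arcᵀ : ∀ {x y} → y ⇾ x ≡ true → outInto x (part y) ≡ c′
    outInto-arcᵀ yx = outInto-wdr (trans (dist~-arcᵀ yx) (sym (dist~-arcᵀ x₀⇾y₀)))

    -- z ⇾ x′ would force c ≡ c′
    c≢c′⇒twin : c ≢ c′ → ∀ {x x′} → part x ≡ part x′ → ∀ z → x ⇾ z ≡ true → x′ ⇾ z ≡ true
    c≢c′⇒twin c≢c′ {x} {x′} px≡px′ z xz with z ⇾ x′ in zx′
    ... | true  = ⊥-elim (c≢c′ (trans (sym (outInto-arc zx′)) (trans (cong (outInto z) (sym px≡px′)) (outInto-arcᵀ xz))))
    ... | false = trans (sym (∨-identityʳ _)) (trans (cong (x′ ⇾ z ∨_) (sym zx′))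
                    (part≢⇒adj (λ px′≡pz → arc⇒part≢ xz (sym (trans px≡px′ px′≡pz)))))

    c≡c′ : c ≡ c′
    c≡c′ = decidable-stable (c ℕ.≟ c′) λ c≢c′ →
      paths₂x₁y₁≢0 (twin⇒paths₂≡0 x₁ y₁ λ z →
        bool-ext (c≢c′⇒twin c≢c′ x₁∼y₁ z) (c≢c′⇒twin c≢c′ (sym x₁∼y₁) z))

    outInto≡c : ∀ x p → part x ≢ p → outInto x p ≡ c
    outInto≡c x p px≢p with x ⇾ member p in e | part≢⇒adj {x} {member p} (λ e → px≢p (trans e (part-member p)))
    ... | true  | _  = trans (cong (outInto x) (sym (part-member p))) (outInto-arc e)
    ... | false | px = trans (cong (outInto x) (sym (part-member p))) (trans (outInto-arcᵀ px) (sym c≡c′))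

    N≡m*L : N ≡ m * L
    N≡m*L = begin
      N                                              ≡⟨ sym (trans (sum-const {N} 1) (*-identityʳ N)) ⟩
      sum {N} (λ _ → 1)                              ≡⟨ sum-fibres part (λ _ → 1) ⟩
      sum (λ p → sum (λ z → δ (part z) p * 1))       ≡⟨ sum-cong-≗ part-size ⟩
      sum {m} (λ _ → L)                              ≡⟨ sum-const {m} L ⟩
      m * L                                          ∎
      where
      open ≡-Reasoning
      part-size : ∀ p → sum (λ z → δ (part z) p * 1) ≡ L
      part-size p = trans (sum-cong-≗ (λ z → *-identityʳ (δ (part z) p))) (sum-δ-part p)

    L+2d≡m*L : L + (d + d) ≡ m * L
    L+2d≡m*L = trans (partSize+2d x₀) N≡m*L

    outInto≡sum : ∀ x p → outInto x p ≡ sum (λ z → δ (part z) p * b2n (x ⇾ z))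
    outInto≡sum x p = trans (countFin-∧≡sum (x ⇾_) (λ z → ⌊ part z ≟ p ⌋))
                            (sum-cong-≗ (λ z → *-comm (b2n (x ⇾ z)) (δ (part z) p)))

    d+c≡m*c : d + c ≡ m * c
    d+c≡m*c = begin
      d + c
        ≡⟨ cong₂ _+_ (trans (sym (outdeg≡d x₀)) (trans (countFin≡sum (x₀ ⇾_)) (sum-fibres part (λ z → b2n (x₀ ⇾ z)))))
                     (sym (sum-δʳ (part x₀) (λ _ → c))) ⟩
      sum (λ p → sum (λ z → δ (part z) p * b2n (x₀ ⇾ z))) + sum (λ p → δ p (part x₀) * c)
        ≡⟨ sym (∑-distrib-+ (λ p → sum (λ z → δ (part z) p * b2n (x₀ ⇾ z))) (λ p → δ p (part x₀) * c)) ⟩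
      sum (λ p → sum (λ z → δ (part z) p * b2n (x₀ ⇾ z)) + δ p (part x₀) * c)
        ≡⟨ sum-cong-≗ per-part ⟩
      sum {m} (λ _ → c)
        ≡⟨ sum-const {m} c ⟩
      m * c ∎
      where
      open ≡-Reasoning
      per-part : ∀ p → sum (λ z → δ (part z) p * b2n (x₀ ⇾ z)) + δ p (part x₀) * c ≡ c
      per-part p with p ≟ part x₀
      ... | yes refl = trans (cong (_+ (c + 0)) (trans (sym (outInto≡sum x₀ p)) (outInto-own-part x₀ p refl)))
                             (+-identityʳ c)
      ... | no p≢px₀ = trans (+-identityʳ _) (trans (sym (outInto≡sum x₀ p)) (outInto≡c x₀ p (p≢px₀ ∘ sym)))

    2c≡L : 2 * c ≡ L
    2c≡L = half-arithmetic parts≥2 L+2d≡m*L d+c≡m*c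

    2*outInto≡L : ∀ x p → part x ≢ p → 2 * outInto x p ≡ L
    2*outInto≡L x p px≢p = trans (cong (2 *_) (outInto≡c x p px≢p)) 2c≡L

    twin? : V Γ → V Γ → Bool
    twin? x y = ⌊ part x ≟ part y ⌋ ∧ (paths₂ x y ≡ᵇ 0)

    nonTwin? : V Γ → V Γ → Bool
    nonTwin? x y = ⌊ part x ≟ part y ⌋ ∧ not (paths₂ x y ≡ᵇ 0)

    twin?-elim : ∀ {x y} → twin? x y ≡ true → part x ≡ part y × paths₂ x y ≡ 0
    twin?-elim e = ⌊≟⌋⇒≡ (∧-conicalˡ _ _ e) , ≡ᵇ-true⇒≡ _ _ (∧-conicalʳ _ _ e)

    twin?-intro : ∀ {x y} → part x ≡ part y → paths₂ x y ≡ 0 → twin? x y ≡ true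
    twin?-intro {x} {y} px≡py none rewrite px≡py | none = cong (_∧ true) (⌊≟⌋-refl (part y))

    twin?⇒Twin : ∀ {x y} → twin? x y ≡ true → Twin x y
    twin?⇒Twin e = paths₂≡0⇒twin _ _ (proj₁ (twin?-elim e)) (proj₂ (twin?-elim e))

    twin?-refl : ∀ x → twin? x x ≡ true
    twin?-refl x = twin?-intro refl (twin⇒paths₂≡0 x x (λ _ → refl))

    twin?-sym : ∀ x y → twin? x y ≡ true → twin? y x ≡ true
    twin?-sym x y e with twin?-elim e
    ... | px≡py , none = twin?-intro (sym px≡py) (trans (sym (paths₂-sym-same-part x y px≡py)) none)

    twin?-trans : ∀ x y z → twin? x y ≡ true → twin? y z ≡ true → twin? x z ≡ true
    twin?-trans x y z e e′ = twin?-intro (trans (proj₁ (twin?-elim e)) (proj₁ (twin?-elim e′)))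
      (twin⇒paths₂≡0 x z (λ w → trans (twin?⇒Twin e w) (twin?⇒Twin e′ w)))

    nonTwin⇒dist≡2 : ∀ x y → part x ≡ part y → paths₂ x y ≢ 0 → dist Γ x y ≡ 2
    nonTwin⇒dist≡2 x y px≡py paths≢0 with countFin-witness (λ z → x ⇾ z ∧ z ⇾ y) paths≢0
    ... | z , xzy = path⇒dist≡2 Γ z x≢y (part≡⇒no-arc px≡py) (∧-conicalˡ _ _ xzy) (∧-conicalʳ _ _ xzy)
      where
      x≢y : x ≢ y
      x≢y refl = paths≢0 (twin⇒paths₂≡0 x x (λ _ → refl))

    nonTwin⇒dist~≡[2,2] : ∀ x y → part x ≡ part y → paths₂ x y ≢ 0 → dist~ Γ x y ≡ (2 , 2)
    nonTwin⇒dist~≡[2,2] x y px≡py paths≢0 = cong₂ _,_ (nonTwin⇒dist≡2 x y px≡py paths≢0)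
      (nonTwin⇒dist≡2 y x (sym px≡py) (λ e → paths≢0 (trans (paths₂-sym-same-part x y px≡py) e)))

    γΓ : ℕ
    γΓ = paths₂ x₁ y₁

    nonTwin⇒paths₂≡γΓ : ∀ x y → part x ≡ part y → paths₂ x y ≢ 0 → paths₂ x y ≡ γΓ
    nonTwin⇒paths₂≡γΓ x y px≡py paths≢0 =
      paths₂-wdr (trans (nonTwin⇒dist~≡[2,2] x y px≡py paths≢0)
                        (sym (nonTwin⇒dist~≡[2,2] x₁ y₁ x₁∼y₁ paths₂x₁y₁≢0)))

    -- count the 2-paths from x into part p by their middle vertex
    sum-paths₂-into-part : ∀ x p → sum (λ y → δ (part y) p * paths₂ x y) ≡ sum (λ z → b2n (x ⇾ z) * outInto z p)
    sum-paths₂-into-part x p = begin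
      sum (λ y → δ (part y) p * paths₂ x y)
        ≡⟨ sum-cong-≗ (λ y → trans (cong (δ (part y) p *_) (countFin-∧≡sum (x ⇾_) (_⇾ y)))
                                   (*-distribˡ-sum (δ (part y) p) (λ z → b2n (x ⇾ z) * b2n (z ⇾ y)))) ⟩
      sum (λ y → sum (λ z → δ (part y) p * (b2n (x ⇾ z) * b2n (z ⇾ y))))
        ≡⟨ ∑-comm (λ y z → δ (part y) p * (b2n (x ⇾ z) * b2n (z ⇾ y))) ⟩
      sum (λ z → sum (λ y → δ (part y) p * (b2n (x ⇾ z) * b2n (z ⇾ y))))
        ≡⟨ sum-cong-≗ (λ z → trans (sum-cong-≗ (λ y → swap (δ (part y) p) (b2n (x ⇾ z)) (b2n (z ⇾ y))))
                                   (sym (*-distribˡ-sum (b2n (x ⇾ z)) (λ y → δ (part y) p * b2n (z ⇾ y))))) ⟩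
      sum (λ z → b2n (x ⇾ z) * sum (λ y → δ (part y) p * b2n (z ⇾ y)))
        ≡⟨ sum-cong-≗ (λ z → cong (b2n (x ⇾ z) *_) (sym (outInto≡sum z p))) ⟩
      sum (λ z → b2n (x ⇾ z) * outInto z p) ∎
      where
      open ≡-Reasoning
      swap : ∀ a b c → a * (b * c) ≡ b * (a * c)
      swap = solve-∀

    nonTwins : V Γ → ℕ
    nonTwins x = countFin (nonTwin? x)

    2γΓ*nonTwins≡d*L : ∀ x → 2 * (γΓ * nonTwins x) ≡ d * L
    2γΓ*nonTwins≡d*L x = begin
      2 * (γΓ * nonTwins x)
        ≡⟨ cong (λ t → 2 * (γΓ * t)) (countFin≡sum (nonTwin? x)) ⟩
      2 * (γΓ * sum (λ y → b2n (nonTwin? x y)))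
        ≡⟨ cong (2 *_) (*-distribˡ-sum γΓ (λ y → b2n (nonTwin? x y))) ⟩
      2 * sum (λ y → γΓ * b2n (nonTwin? x y))
        ≡⟨ cong (2 *_) (trans (sum-cong-≗ (λ y → sym (paths₂-in-part y))) (sum-paths₂-into-part x (part x))) ⟩
      2 * sum (λ z → b2n (x ⇾ z) * outInto z (part x))
        ≡⟨ *-distribˡ-sum 2 (λ z → b2n (x ⇾ z) * outInto z (part x)) ⟩
      sum (λ z → 2 * (b2n (x ⇾ z) * outInto z (part x)))
        ≡⟨ sum-cong-≗ out-neighbour ⟩
      sum (λ z → b2n (x ⇾ z) * L)
        ≡⟨ sym (*-distribʳ-sum L (λ z → b2n (x ⇾ z))) ⟩
      sum (λ z → b2n (x ⇾ z)) * L
        ≡⟨ cong (_* L) (trans (sym (countFin≡sum (x ⇾_))) (outdeg≡d x)) ⟩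
      d * L ∎
      where
      open ≡-Reasoning
      paths₂-in-part : ∀ y → δ (part y) (part x) * paths₂ x y ≡ γΓ * b2n (nonTwin? x y)
      paths₂-in-part y with part x ≟ part y | part y ≟ part x
      ... | no _ | no _ = sym (*-zeroʳ γΓ)
      ... | yes e | no ne = ⊥-elim (ne (sym e))
      ... | no ne | yes e = ⊥-elim (ne (sym e))
      ... | yes px≡py | yes _ with paths₂ x y ≡ᵇ 0 in e
      ...   | true  = trans (+-identityʳ _) (trans (≡ᵇ-true⇒≡ _ _ e) (sym (*-zeroʳ γΓ)))
      ...   | false = trans (+-identityʳ _) (trans (nonTwin⇒paths₂≡γΓ x y px≡py (λ none → true≢false
                        (trans (sym (cong (_≡ᵇ 0) none)) e))) (sym (*-identityʳ γΓ)))
      out-neighbour : ∀ z → 2 * (b2n (x ⇾ z) * outInto z (part x)) ≡ b2n (x ⇾ z) * L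
      out-neighbour z with x ⇾ z in xz
      ... | false = refl
      ... | true  = trans (cong (2 *_) (+-identityʳ (outInto z (part x))))
                           (trans (2*outInto≡L z (part x) (arc⇒part≢ xz)) (sym (+-identityʳ L)))

    instance
      γΓ-nonZero : NonZero γΓ
      γΓ-nonZero = ≢-nonZero paths₂x₁y₁≢0

    nonTwins≡ : ∀ x → nonTwins x ≡ nonTwins x₀
    nonTwins≡ x = *-cancelˡ-≡ _ _ γΓ (*-cancelˡ-≡ _ _ 2
      (trans (2γΓ*nonTwins≡d*L x) (sym (2γΓ*nonTwins≡d*L x₀))))

    classSize : V Γ → ℕ
    classSize x = countFin (twin? x)

    classSize+nonTwins≡L : ∀ x → classSize x + nonTwins x ≡ L
    classSize+nonTwins≡L x = begin
      classSize x + nonTwins x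
        ≡⟨ cong₂ _+_ (countFin≡sum (twin? x)) (countFin≡sum (nonTwin? x)) ⟩
      sum (λ y → b2n (twin? x y)) + sum (λ y → b2n (nonTwin? x y))
        ≡⟨ sym (∑-distrib-+ (λ y → b2n (twin? x y)) (λ y → b2n (nonTwin? x y))) ⟩
      sum (λ y → b2n (twin? x y) + b2n (nonTwin? x y))
        ≡⟨ sum-cong-≗ (λ y → split ⌊ part x ≟ part y ⌋ (paths₂ x y ≡ᵇ 0)) ⟩
      sum (λ y → b2n ⌊ part x ≟ part y ⌋)
        ≡⟨ sum-cong-≗ (λ y → δ-sym (part x) (part y)) ⟩
      sum (λ y → δ (part y) (part x))
        ≡⟨ sym (countFin≡sum (λ y → ⌊ part y ≟ part x ⌋)) ⟩
      partSize part (part x)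
        ≡⟨ partSize≡L (part x) ⟩
      L ∎
      where
      open ≡-Reasoning
      split : ∀ a b → b2n (a ∧ b) + b2n (a ∧ not b) ≡ b2n a
      split true  true  = refl
      split true  false = refl
      split false _     = refl

    n : ℕ
    n = classSize x₀

    classSize≡n : ∀ x → classSize x ≡ n
    classSize≡n x = +-cancelʳ-≡ (nonTwins x₀) _ _
      (trans (cong (classSize x +_) (sym (nonTwins≡ x))) (trans (classSize+nonTwins≡L x) (sym (classSize+nonTwins≡L x₀))))

    n≥1 : 1 ≤ n
    n≥1 = countFin-≥1 (twin? x₀) x₀ (twin?-refl x₀)

    instance
      n-nonZero : NonZero n
      n-nonZero = >-nonZero n≥1

    open Quotient (quotient twin? twin?-refl twin?-sym twin?-trans)

    twin?-rep : ∀ x → twin? x (rep [ x ]) ≡ true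
    twin?-rep x = complete x (rep [ x ]) (sym ([rep] [ x ]))

    part-rep : ∀ x → part (rep [ x ]) ≡ part x
    part-rep x = sym (proj₁ (twin?-elim (twin?-rep x)))

    Δ : Digraph
    Δ = record { size = classes ; arc = λ i j → rep i ⇾ rep j ; loopless = λ i → loopless Γ (rep i) }

    infix 7 _⇾Δ_
    _⇾Δ_ : Fin classes → Fin classes → Bool
    i ⇾Δ j = arc Δ i j

    partΔ : Fin classes → Fin m
    partΔ i = part (rep i)

    arc-factorsΔ : ∀ x y → x ⇾ y ≡ [ x ] ⇾Δ [ y ]
    arc-factorsΔ x y = twin-arc-cong (sym (part-rep x)) (twin?⇒Twin (twin?-rep x))
                                     (sym (part-rep y)) (twin?⇒Twin (twin?-rep y))

    class-size : ∀ k → countFin (λ z → ⌊ [ z ] ≟ k ⌋) ≡ n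
    class-size k = trans (countFin-cong in-class) (classSize≡n (rep k))
      where
      in-class : ∀ z → ⌊ [ z ] ≟ k ⌋ ≡ twin? (rep k) z
      in-class z = bool-ext
        (λ e → twin?-sym z (rep k) (complete z (rep k) (trans (⌊≟⌋⇒≡ e) (sym ([rep] k)))))
        (λ e → trans (cong (λ t → ⌊ [ z ] ≟ t ⌋) (trans (sym ([rep] k)) (sound (rep k) z e))) (⌊≟⌋-refl [ z ]))

    Γ≅Δ[n] : Isomorphic Γ (cocliqueExt Δ n)
    Γ≅Δ[n] = isomorphic-cocliqueExt Γ Δ n [_] class-size arc-factorsΔ

    countFin-lift : ∀ (F : Fin classes → Bool) → countFin (λ z → F [ z ]) ≡ n * countFin F
    countFin-lift F = trans (countFin≡sum (λ z → F [ z ])) (trans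
      (sum-∘-equifibred [_] n (λ k → trans (sym (countFin≡sum (λ z → ⌊ [ z ] ≟ k ⌋))) (class-size k)) (λ k → b2n (F k)))
      (cong (n *_) (sym (countFin≡sum F))))

    rep⇾ : ∀ i z → rep i ⇾ z ≡ i ⇾Δ [ z ]
    rep⇾ i z = trans (arc-factorsΔ (rep i) z) (cong (_⇾Δ [ z ]) ([rep] i))

    ⇾rep : ∀ z j → z ⇾ rep j ≡ [ z ] ⇾Δ j
    ⇾rep z j = trans (arc-factorsΔ z (rep j)) (cong ([ z ] ⇾Δ_) ([rep] j))

    paths₂Δ : Fin classes → Fin classes → ℕ
    paths₂Δ i j = countFin (λ k → i ⇾Δ k ∧ k ⇾Δ j)

    outIntoΔ : Fin classes → Fin m → ℕ
    outIntoΔ i p = countFin (λ k → i ⇾Δ k ∧ ⌊ partΔ k ≟ p ⌋)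

    paths₂-lift : ∀ i j → paths₂ (rep i) (rep j) ≡ n * paths₂Δ i j
    paths₂-lift i j = trans (countFin-cong (λ z → cong₂ _∧_ (rep⇾ i z) (⇾rep z j)))
                            (countFin-lift (λ k → i ⇾Δ k ∧ k ⇾Δ j))

    outInto-lift : ∀ i p → outInto (rep i) p ≡ n * outIntoΔ i p
    outInto-lift i p = trans (countFin-cong (λ z → cong₂ (λ a q → a ∧ ⌊ q ≟ p ⌋) (rep⇾ i z) (sym (part-rep z))))
                             (countFin-lift (λ k → i ⇾Δ k ∧ ⌊ partΔ k ≟ p ⌋))

    outdeg-lift : ∀ i → d ≡ n * outdeg Δ i
    outdeg-lift i = trans (sym (outdeg≡d (rep i))) (trans (countFin-cong (rep⇾ i)) (countFin-lift (i ⇾Δ_)))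

    indeg-lift : ∀ i → d ≡ n * indeg Δ i
    indeg-lift i = trans (sym (indeg≡d (rep i))) (trans (countFin-cong (λ z → ⇾rep z i)) (countFin-lift (_⇾Δ i)))

    partSize-lift : ∀ p → L ≡ n * partSize partΔ p
    partSize-lift p = trans (sym (partSize≡L p))
      (trans (countFin-cong (λ z → cong (λ q → ⌊ q ≟ p ⌋) (sym (part-rep z)))) (countFin-lift (λ k → ⌊ partΔ k ≟ p ⌋)))

    l : ℕ
    l = partSize partΔ (part x₀)

    partSizeΔ≡l : ∀ p → partSize partΔ p ≡ l
    partSizeΔ≡l p = *-cancelˡ-≡ _ _ n (trans (sym (partSize-lift p)) (partSize-lift (part x₀)))

    L≡n*l : L ≡ n * l
    L≡n*l = partSize-lift (part x₀)

    l≥2 : 2 ≤ l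
    l≥2 = subst (2 ≤_) (partSizeΔ≡l (part x₁))
      (countFin-≥2 (λ k → ⌊ partΔ k ≟ part x₁ ⌋) [ x₁ ] [ y₁ ]
        (trans (cong (λ q → ⌊ q ≟ part x₁ ⌋) (part-rep x₁)) (⌊≟⌋-refl (part x₁)))
        (trans (cong (λ q → ⌊ q ≟ part x₁ ⌋) (trans (part-rep y₁) (sym x₁∼y₁))) (⌊≟⌋-refl (part x₁)))
        (λ e → paths₂x₁y₁≢0 (proj₂ (twin?-elim (complete x₁ y₁ e)))))

    no-digonΔ : ∀ {i j} → i ⇾Δ j ≡ true → j ⇾Δ i ≡ false
    no-digonΔ = no-digon

    regularΔ : Regular Δ
    regularΔ = outdeg Δ [ x₀ ] , λ i →
      *-cancelˡ-≡ _ _ n (trans (sym (outdeg-lift i)) (outdeg-lift [ x₀ ])) ,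
      *-cancelˡ-≡ _ _ n (trans (sym (indeg-lift i)) (outdeg-lift [ x₀ ]))

    multipartiteΔ : CompleteMultipartiteWith Δ partΔ
    multipartiteΔ i j = multipartite (rep i) (rep j)

    team-tournamentΔ : TeamTournament Δ m l partΔ
    team-tournamentΔ = no-digon⇒girth≥3 Δ no-digonΔ , partSizeΔ≡l , multipartiteΔ

    type-IIΔ : ∀ i p → partΔ i ≢ p → 2 * outIntoΔ i p ≡ l
    type-IIΔ i p pi≢p = *-cancelˡ-≡ _ _ n (begin
      n * (2 * outIntoΔ i p)    ≡⟨ swap n (outIntoΔ i p) ⟩
      2 * (n * outIntoΔ i p)    ≡⟨ cong (2 *_) (sym (outInto-lift i p)) ⟩
      2 * outInto (rep i) p     ≡⟨ 2*outInto≡L (rep i) p pi≢p ⟩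
      L                         ≡⟨ L≡n*l ⟩
      n * l                     ∎)
      where
      open ≡-Reasoning
      swap : ∀ a b → a * (2 * b) ≡ 2 * (a * b)
      swap = solve-∀

    αΓ : ℕ
    αΓ = paths₂ x₀ y₀

    paths₂-arc : ∀ {x y} → x ⇾ y ≡ true → paths₂ x y ≡ αΓ
    paths₂-arc xy = paths₂-wdr (trans (dist~-arc xy) (sym (dist~-arc x₀⇾y₀)))

    -- the two out-decompositions of an arc differ only in paths₂, since c ≡ c′
    paths₂-back≡αΓ : paths₂ y₀ x₀ ≡ αΓ
    paths₂-back≡αΓ = +-cancelʳ-≡ c _ _ (+-cancelˡ-≡ (commonOut x₀ y₀) _ _ (begin
      commonOut x₀ y₀ + (paths₂ y₀ x₀ + c)   ≡⟨ sym (+-assoc (commonOut x₀ y₀) _ c) ⟩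
      commonOut x₀ y₀ + paths₂ y₀ x₀ + c     ≡⟨ cong₂ (λ u v → u + paths₂ y₀ x₀ + v) (commonOut-sym x₀ y₀) c≡c′ ⟩
      commonOut y₀ x₀ + paths₂ y₀ x₀ + c′    ≡⟨ out-decomposition y₀ x₀ ⟩
      d                                      ≡⟨ sym (out-decomposition x₀ y₀) ⟩
      commonOut x₀ y₀ + αΓ + c               ≡⟨ +-assoc (commonOut x₀ y₀) αΓ c ⟩
      commonOut x₀ y₀ + (αΓ + c)             ∎))
      where open ≡-Reasoning

    paths₂-arcᵀ : ∀ {x y} → y ⇾ x ≡ true → paths₂ x y ≡ αΓ
    paths₂-arcᵀ yx = trans (paths₂-wdr (trans (dist~-arcᵀ yx) (sym (dist~-arcᵀ x₀⇾y₀)))) paths₂-back≡αΓ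

    sum-paths₂-into-part-y₀ : sum (λ y → δ (part y) (part y₀) * paths₂ x₀ y) ≡ αΓ * L
    sum-paths₂-into-part-y₀ = begin
      sum (λ y → δ (part y) (part y₀) * paths₂ x₀ y) ≡⟨ sum-cong-≗ adjacent ⟩
      sum (λ y → αΓ * δ (part y) (part y₀))          ≡⟨ sym (*-distribˡ-sum αΓ (λ y → δ (part y) (part y₀))) ⟩
      αΓ * sum (λ y → δ (part y) (part y₀))          ≡⟨ cong (αΓ *_) (sum-δ-part (part y₀)) ⟩
      αΓ * L                                         ∎
      where
      open ≡-Reasoning
      adjacent : ∀ y → δ (part y) (part y₀) * paths₂ x₀ y ≡ αΓ * δ (part y) (part y₀)
      adjacent y with part y ≟ part y₀ | x₀ ⇾ y in x₀y
      ... | no _       | _     = sym (*-zeroʳ αΓ)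
      ... | yes _      | true  = trans (+-identityʳ _) (trans (paths₂-arc x₀y) (sym (*-identityʳ αΓ)))
      ... | yes py≡py₀ | false = trans (+-identityʳ _) (trans (paths₂-arcᵀ yx₀) (sym (*-identityʳ αΓ)))
        where
        yx₀ : y ⇾ x₀ ≡ true
        yx₀ = trans (sym (cong (_∨ y ⇾ x₀) x₀y))
                    (part≢⇒adj (λ px₀≡py → arc⇒part≢ x₀⇾y₀ (sym (trans px₀≡py py≡py₀))))

    2αΓL+Lc≡Ld : 2 * (αΓ * L) + L * c ≡ L * d
    2αΓL+Lc≡Ld = begin
      2 * (αΓ * L) + L * c
        ≡⟨ cong₂ (λ u v → 2 * u + L * v) (trans (sym sum-paths₂-into-part-y₀) (sum-paths₂-into-part x₀ (part y₀)))
                                         (countFin≡sum (λ z → x₀ ⇾ z ∧ ⌊ part z ≟ part y₀ ⌋)) ⟩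
      2 * sum f + L * sum g                ≡⟨ cong₂ _+_ (*-distribˡ-sum 2 f) (*-distribˡ-sum L g) ⟩
      sum (λ z → 2 * f z) + sum (λ z → L * g z)  ≡⟨ sym (∑-distrib-+ (λ z → 2 * f z) (λ z → L * g z)) ⟩
      sum (λ z → 2 * f z + L * g z)        ≡⟨ sum-cong-≗ out-neighbour ⟩
      sum (λ z → L * b2n (x₀ ⇾ z))         ≡⟨ sym (*-distribˡ-sum L (λ z → b2n (x₀ ⇾ z))) ⟩
      L * sum (λ z → b2n (x₀ ⇾ z))         ≡⟨ cong (L *_) (trans (sym (countFin≡sum (x₀ ⇾_))) (outdeg≡d x₀)) ⟩
      L * d                                ∎
      where
      open ≡-Reasoning
      f g : V Γ → ℕ
      f z = b2n (x₀ ⇾ z) * outInto z (part y₀)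
      g z = b2n (x₀ ⇾ z ∧ ⌊ part z ≟ part y₀ ⌋)
      out-neighbour : ∀ z → 2 * f z + L * g z ≡ L * b2n (x₀ ⇾ z)
      out-neighbour z with x₀ ⇾ z
      ... | false = refl
      ... | true with part z ≟ part y₀
      ...   | yes pz≡py₀ rewrite outInto-own-part z (part y₀) pz≡py₀ = refl
      ...   | no pz≢py₀ = trans (cong₂ _+_ (trans (cong (2 *_) (+-identityʳ (outInto z (part y₀))))
                                                   (2*outInto≡L z (part y₀) pz≢py₀))
                                            (*-zeroʳ L))
                                (trans (+-identityʳ L) (sym (*-identityʳ L)))

    4αΓ+L≡2d : 4 * αΓ + L ≡ d + d
    4αΓ+L≡2d = *-cancelˡ-≡ _ _ L (begin
      L * (4 * αΓ + L)                    ≡⟨ expand L αΓ ⟩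
      2 * (2 * (αΓ * L)) + L * L          ≡⟨ cong (λ t → 2 * (2 * (αΓ * L)) + L * t) (sym 2c≡L) ⟩
      2 * (2 * (αΓ * L)) + L * (2 * c)    ≡⟨ factor L αΓ c ⟩
      2 * (2 * (αΓ * L) + L * c)          ≡⟨ cong (2 *_) 2αΓL+Lc≡Ld ⟩
      2 * (L * d)                         ≡⟨ double L d ⟩
      L * (d + d)                         ∎)
      where
      open ≡-Reasoning
      expand : ∀ L a → L * (4 * a + L) ≡ 2 * (2 * (a * L)) + L * L
      expand = solve-∀
      factor : ∀ L a c → 2 * (2 * (a * L)) + L * (2 * c) ≡ 2 * (2 * (a * L) + L * c)
      factor = solve-∀
      double : ∀ L d → 2 * (L * d) ≡ L * (d + d)
      double = solve-∀

    α γ : ℕ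
    α = paths₂Δ [ x₀ ] [ y₀ ]
    γ = paths₂Δ [ x₁ ] [ y₁ ]

    [x₀]⇾Δ[y₀] : [ x₀ ] ⇾Δ [ y₀ ] ≡ true
    [x₀]⇾Δ[y₀] = trans (sym (arc-factorsΔ x₀ y₀)) x₀⇾y₀

    rep-nonTwins : ∀ {i j} → i ≢ j → partΔ i ≡ partΔ j → paths₂ (rep i) (rep j) ≢ 0
    rep-nonTwins {i} {j} i≢j same none = i≢j (trans (sym ([rep] i)) (trans (sound _ _ (twin?-intro same none)) ([rep] j)))

    n*α≡αΓ : n * α ≡ αΓ
    n*α≡αΓ = trans (sym (paths₂-lift _ _)) (paths₂-arc [x₀]⇾Δ[y₀])

    n*γ≡γΓ : n * γ ≡ γΓ
    n*γ≡γΓ = trans (sym (paths₂-lift _ _)) (nonTwin⇒paths₂≡γΓ _ _ same-part (rep-nonTwins distinct same-part))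
      where
      same-part : partΔ [ x₁ ] ≡ partΔ [ y₁ ]
      same-part = trans (part-rep x₁) (trans x₁∼y₁ (sym (part-rep y₁)))
      distinct : [ x₁ ] ≢ [ y₁ ]
      distinct e = paths₂x₁y₁≢0 (proj₂ (twin?-elim (complete x₁ y₁ e)))

    paths₂Δ-arc : ∀ {i j} → i ⇾Δ j ≡ true → paths₂Δ i j ≡ α
    paths₂Δ-arc ij = *-cancelˡ-≡ _ _ n (trans (sym (paths₂-lift _ _)) (trans (paths₂-arc ij) (sym n*α≡αΓ)))

    paths₂Δ-arcᵀ : ∀ {i j} → j ⇾Δ i ≡ true → paths₂Δ i j ≡ α
    paths₂Δ-arcᵀ ji = *-cancelˡ-≡ _ _ n (trans (sym (paths₂-lift _ _)) (trans (paths₂-arcᵀ ji) (sym n*α≡αΓ)))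

    paths₂Δ-nonadjacent : ∀ {i j} → i ≢ j → i ⇾Δ j ≡ false → j ⇾Δ i ≡ false → paths₂Δ i j ≡ γ
    paths₂Δ-nonadjacent {i} {j} i≢j ij ji = *-cancelˡ-≡ _ _ n (trans (sym (paths₂-lift _ _))
      (trans (nonTwin⇒paths₂≡γΓ _ _ same-part (rep-nonTwins i≢j same-part)) (sym n*γ≡γΓ)))
      where
      same-part : partΔ i ≡ partΔ j
      same-part = decidable-stable (partΔ i ≟ partΔ j)
        (λ pi≢pj → true≢false (trans (sym (part≢⇒adj pi≢pj)) (cong₂ _∨_ ij ji)))

    paths₂Δ-diagonal : ∀ i → paths₂Δ i i ≡ 0
    paths₂Δ-diagonal i = countFin-allFalse (λ k → i ⇾Δ k ∧ k ⇾Δ i) λ k → ∧-exclusive no-digonΔ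

    doubly-regular-at : ∀ i j (i≟j : Dec (i ≡ j)) u v → i ⇾Δ j ≡ u → j ⇾Δ i ≡ v →
      paths₂Δ i j ≡ α * b2n u + α * b2n v + γ * (1 ∸ (b2n ⌊ i≟j ⌋ + b2n u + b2n v))
    doubly-regular-at i .i (yes refl) true  _     ii _  = ⊥-elim (true≢false (trans (sym ii) (loopless Δ i)))
    doubly-regular-at i .i (yes refl) false true  _  ii = ⊥-elim (true≢false (trans (sym ii) (loopless Δ i)))
    doubly-regular-at i .i (yes refl) false false _  _  = trans (paths₂Δ-diagonal i) (only-ε α γ)
      where
      only-ε : ∀ α γ → 0 ≡ α * 0 + α * 0 + γ * 0
      only-ε = solve-∀
    doubly-regular-at i j  (no _)     true  true  ij ji = ⊥-elim (true≢false (trans (sym ji) (no-digonΔ ij)))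
    doubly-regular-at i j  (no _)     true  false ij _  = trans (paths₂Δ-arc ij) (only-α α γ)
      where
      only-α : ∀ α γ → α ≡ α * 1 + α * 0 + γ * 0
      only-α = solve-∀
    doubly-regular-at i j  (no _)     false true  _  ji = trans (paths₂Δ-arcᵀ ji) (only-β α γ)
      where
      only-β : ∀ α γ → α ≡ α * 0 + α * 1 + γ * 0
      only-β = solve-∀
    doubly-regular-at i j  (no i≢j)   false false ij ji = trans (paths₂Δ-nonadjacent i≢j ij ji) (only-γ α γ)
      where
      only-γ : ∀ α γ → γ ≡ α * 0 + α * 0 + γ * 1
      only-γ = solve-∀

    doubly-regularΔ : DoublyRegularEq Δ α α γ
    doubly-regularΔ i j = doubly-regular-at i j (i ≟ j) (i ⇾Δ j) (j ⇾Δ i) refl refl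

    type-II : TypeII Δ m l partΔ α α
    type-II = refl , (outIntoΔ [ x₀ ] (part y₀) , sym (type-IIΔ [ x₀ ] (part y₀) px₀≢py₀)) , type-IIΔ
      where
      px₀≢py₀ : partΔ [ x₀ ] ≢ part y₀
      px₀≢py₀ e = arc⇒part≢ x₀⇾y₀ (sym (trans (sym (part-rep x₀)) e))

    4α≡[m-2]l : 4 * α ≡ (m ∸ 2) * l
    4α≡[m-2]l = α-arithmetic {d = d} parts≥2 L≡n*l (subst (λ a → 4 * a + L ≡ d + d) (sym n*α≡αΓ) 4αΓ+L≡2d) L+2d≡m*L

    4[l-1]γ≡l²[m-1] : 4 * (l ∸ 1) * γ ≡ l * l * (m ∸ 1)
    4[l-1]γ≡l²[m-1] =
      γ-arithmetic {d = d} {U = nonTwins x₀} parts≥2 (≤-trans (s≤s z≤n) l≥2) L≡n*l (classSize+nonTwins≡L x₀)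
      (subst (λ g → 2 * (g * nonTwins x₀) ≡ d * L) (sym n*γ≡γΓ) (2γΓ*nonTwins≡d*L x₀)) L+2d≡m*L

    caseB : CaseB Γ
    caseB = m , l , n , Δ , partΔ , α , α , γ , parts≥2 , l≥2 , n≥1 ,
            (team-tournamentΔ , regularΔ , doubly-regularΔ) , type-II ,
            4α≡[m-2]l , 4α≡[m-2]l , 4[l-1]γ≡l²[m-1] , Γ≅Δ[n]

  classification : CaseA Γ ⊎ CaseB Γ
  classification with any? (λ x → any? (λ y → (part x ≟ part y) ×-dec ¬? (paths₂ x y ℕ.≟ 0)))
  ... | yes (x₁ , y₁ , x₁∼y₁ , paths≢0) = inj₂ (TwinQuotient.caseB x₁∼y₁ paths≢0)
  ... | no no-pair = inj₁ (AllTwins.caseA λ x y px≡py →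
                       decidable-stable (paths₂ x y ℕ.≟ 0) (λ paths≢0 → no-pair (x , y , px≡py , paths≢0)))

proposition6p1 : (Γ : Digraph) → SemicompleteMultipartite Γ →
    WeaklyDistanceRegular Γ → Commutative Γ → ExactlyOneT Γ →
    CaseA Γ ⊎ CaseB Γ
proposition6p1 Γ (m , part , parts≥2 , part-size≥2 , multipartite)
               ((x₀ , y₀ , x₀⇾y₀ , y₀↛x₀) , _ , wdr) comm (_ , _ , T-unique) =
  Setting.classification Γ part parts≥2 part-size≥2 multipartite x₀⇾y₀ y₀↛x₀ wdr comm T-unique
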